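{- For all $s_1,s_2\in\mathbb{N}$, $\epsilon_1,\epsilon_2\in\mathbb{F}_q^\times$ and $d\in\mathbb{Z}_{\ge0}$, $$S_d(s_1;\epsilon_1)S_d(s_2;\epsilon_2)-S_d(s_1+s_2;\epsilon_1\epsilon_2)=\sum_{\substack{0<j<s_1+s_2\\ (q-1)\mid j}}\Delta^{j}_{s_1,s_2}\,S_d(s_1+s_2-j,\,j;\ \epsilon_1\epsilon_2,\,1),$$ where $\Delta^{j}_{s_1,s_2}=(-1)^{s_1-1}\binom{j-1}{s_1-1}+(-1)^{s_2-1}\binom{j-1}{s_2-1}$.
   Context: Let $q$ be a prime power, $A=\mathbb{F}_q[\theta]$, $A_{d+}$ the set of monic polynomials of degree $d$ in $A$, $k=\mathbb{F}_q(\theta)$, $\mathbb{N}=\{1,2,\ldots\}$. For $s\in\mathbb{N}$, $\epsilon\in\mathbb{F}_q^\times$, $d\in\mathbb{Z}_{\ge0}$, the alternating power sum is $S_d(s;\epsilon)=\sum_{a\in A_{d+}}\epsilon^d/a^s\in k$. For $s_1,s_2\in\mathbb{N}$ and $\epsilon_1,\epsilon_2\in\mathbb{F}_q^\times$, $S_d(s_1,s_2;\epsilon_1,\epsilon_2)=S_d(s_1;\epsilon_1)\sum_{d>d_2\ge0}S_{d_2}(s_2;\epsilon_2)$ (an empty sum is $0$). -}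

module Defs where

open import Level using (0ℓ)
open import Data.Nat using (ℕ; zero; suc; _∸_) renaming (_+_ to _+ℕ_)
open import Data.Nat.Divisibility using (_∣?_)
open import Data.Nat.Combinatorics using (_C_)
open import Data.List using (List; []; _∷_; _++_; [_]; map; concatMap; length)
open import Data.List.Relation.Unary.All using (All)
open import Data.List.Relation.Unary.Unique.Propositional using (Unique)
open import Data.List.Membership.Propositional using (_∈_)
open import Data.Product using (_×_; _,_)
open import Relation.Binary.PropositionalEquality using (_≡_; _≢_)
open import Relation.Nullary using (does; ¬_)
open import Algebra.Structures using (IsCommutativeRing)
open import Data.Bool using (if_then_else_)
open import Data.Empty using (⊥)

record FiniteField : Set₁ where
  infixl 6 _⊕_
  infixl 7 _⊗_
  field
    Carrier : Set
    _⊕_ _⊗_ : Carrier → Carrier → Carrier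
    ⊖_ : Carrier → Carrier
    𝟘 𝟙 : Carrier
    isCommutativeRing : IsCommutativeRing _≡_ _⊕_ _⊗_ ⊖_ 𝟘 𝟙
    𝟘≢𝟙 : 𝟘 ≢ 𝟙
    inverse : ∀ x → x ≢ 𝟘 → Carrier
    inverse-correct : ∀ x (p : x ≢ 𝟘) → x ⊗ inverse x p ≡ 𝟙
    elements : List Carrier
    elements-unique : Unique elements
    elements-complete : ∀ x → x ∈ elements

module _ (𝔽 : FiniteField) where
  open FiniteField 𝔽

  card : ℕ
  card = length elements

  powF : Carrier → ℕ → Carrier
  powF x zero = 𝟙
  powF x (suc n) = x ⊗ powF x n

  natF : ℕ → Carrier
  natF zero = 𝟘
  natF (suc n) = 𝟙 ⊕ natF n

  -- A = F_q[θ]: polynomials as coefficient lists, constant term first.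
  Poly : Set
  Poly = List Carrier

  addP : Poly → Poly → Poly
  addP [] g = g
  addP (a ∷ f) [] = a ∷ f
  addP (a ∷ f) (b ∷ g) = (a ⊕ b) ∷ addP f g

  scaleP : Carrier → Poly → Poly
  scaleP c f = map (c ⊗_) f

  mulP : Poly → Poly → Poly
  mulP [] g = []
  mulP (a ∷ f) g = addP (scaleP a g) (𝟘 ∷ mulP f g)

  oneP : Poly
  oneP = [ 𝟙 ]

  powP : Poly → ℕ → Poly
  powP f zero = oneP
  powP f (suc n) = mulP f (powP f n)

  -- equality of polynomials (independent of trailing zero coefficients)
  _≈P_ : Poly → Poly → Set
  f ≈P g = All (_≡ 𝟘) (addP f (map ⊖_ g))

  coeffLists : ℕ → List Poly
  coeffLists zero = [ [] ]
  coeffLists (suc n) = concatMap (λ c → map (c ∷_) (coeffLists n)) elements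

  monic : ℕ → List Poly
  monic d = map (λ v → v ++ [ 𝟙 ]) (coeffLists d)

  -- k = F_q(θ): fractions numerator / denominator.  All denominators that
  -- occur below are products of monic polynomials, hence nonzero.
  Frac : Set
  Frac = Poly × Poly

  _≈k_ : Frac → Frac → Set
  (n₁ , d₁) ≈k (n₂ , d₂) = mulP n₁ d₂ ≈P mulP n₂ d₁

  zeroK : Frac
  zeroK = ([] , oneP)

  constK : Carrier → Frac
  constK c = ([ c ] , oneP)

  addK : Frac → Frac → Frac
  addK (n₁ , d₁) (n₂ , d₂) = (addP (mulP n₁ d₂) (mulP n₂ d₁) , mulP d₁ d₂)

  mulK : Frac → Frac → Frac
  mulK (n₁ , d₁) (n₂ , d₂) = (mulP n₁ n₂ , mulP d₁ d₂)

  negK : Frac → Frac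
  negK (n , d) = (map ⊖_ n , d)

  subK : Frac → Frac → Frac
  subK x y = addK x (negK y)

  sumK : List Frac → Frac
  sumK [] = zeroK
  sumK (x ∷ xs) = addK x (sumK xs)

  S₁ : ℕ → ℕ → Carrier → Frac
  S₁ d s ε = sumK (map (λ a → ([ powF ε d ] , powP a s)) (monic d))

  S₁< : ℕ → ℕ → Carrier → Frac
  S₁< zero s ε = zeroK
  S₁< (suc d) s ε = addK (S₁ d s ε) (S₁< d s ε)

  S₂ : ℕ → ℕ → ℕ → Carrier → Carrier → Frac
  S₂ d s₁ s₂ ε₁ ε₂ = mulK (S₁ d s₁ ε₁) (S₁< d s₂ ε₂)

  Δ : ℕ → ℕ → ℕ → Carrier
  Δ s₁ s₂ j = powF (⊖ 𝟙) (s₁ ∸ 1) ⊗ natF ((j ∸ 1) C (s₁ ∸ 1))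
            ⊕ powF (⊖ 𝟙) (s₂ ∸ 1) ⊗ natF ((j ∸ 1) C (s₂ ∸ 1))

  range1 : ℕ → List ℕ
  range1 zero = []
  range1 (suc m) = range1 m ++ [ suc m ]

  admissibleJs : ℕ → List ℕ
  admissibleJs n = Data.List.filter (λ j → (card ∸ 1) ∣? j) (range1 (n ∸ 1))

  RHS : ℕ → ℕ → ℕ → Carrier → Carrier → Frac
  RHS d s₁ s₂ ε₁ ε₂ =
    sumK (map (λ j → mulK (constK (Δ s₁ s₂ j))
                          (S₂ d (s₁ +ℕ s₂ ∸ j) j (ε₁ ⊗ ε₂) 𝟙))
              (admissibleJs (s₁ +ℕ s₂)))

  LHS : ℕ → ℕ → ℕ → Carrier → Carrier → Frac
  LHS d s₁ s₂ ε₁ ε₂ = subK (mulK (S₁ d s₁ ε₁) (S₁ d s₂ ε₂)) (S₁ d (s₁ +ℕ s₂) (ε₁ ⊗ ε₂))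

{-# OPTIONS --safe #-}
-- Let a run over A_{d+} and t over the polynomials of degree < d, so that b = a + t also runs over A_{d+}.
-- Then S_d(s₁)S_d(s₂) = Σ_{a,t} a^{-s₁}(a+t)^{-s₂}; the terms t = 0 give S_d(s₁+s₂), and for t ≠ 0 the partial
-- fraction identity 1/(a(a+t)) = (1/t)(1/a - 1/(a+t)) gives a Pascal-type recursion in (s₁, s₂) whose solution
-- expands the product into terms Σ_a a^{-(s₁+s₂-j)} · Σ_{t≠0} t^{-j} with signed binomial coefficients.
-- Splitting t by its leading coefficient c, Σ_{t≠0} t^{-j} = (Σ_{c∈𝔽_q^×} c^{-j}) S_{<d}(j), and the sum
-- Σ_{c∈𝔽_q^×} c^{-j} is -1 when (q-1) ∣ j and 0 otherwise; the sign -1 turns the binomial coefficients into Δ^j.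
module Submission where

open import Defs using (FiniteField)
open import Algebra.Bundles using (CommutativeRing; CommutativeMonoid)
open import Level using (0ℓ)

module RingSolver (R : CommutativeRing 0ℓ 0ℓ) where

  open import Data.Nat as ℕ using (ℕ)
  open import Data.Maybe using (Maybe; just; nothing)
  open import Relation.Nullary using (yes; no)
  open import Relation.Binary.PropositionalEquality as P using ()
  open CommutativeRing R
  open import Algebra.Properties.Semiring.Mult semiring using (_×_)

  -- The solver only needs a sound test for equality of numerals: comparing them in ℕ suffices.
  private
    numerals≈? : ∀ m n → Maybe (m × 1# ≈ n × 1#)
    numerals≈? m n with m ℕ.≟ n
    ... | yes P.refl = just refl
    ... | no _ = nothing

  open import Algebra.Solver.Ring.NaturalCoefficients commutativeSemiring numerals≈? public

module FieldProperties (𝔽 : FiniteField) where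

  import Defs

  open import Level using (0ℓ)
  open import Data.Nat using (ℕ)
  open import Data.List using (List; []; _∷_; [_])
  open import Data.List.Relation.Unary.Any using (here; there)
  open import Data.List.Relation.Unary.All as All using ([]; _∷_)
  open import Data.List.Relation.Unary.AllPairs using ([]; _∷_)
  open import Data.List.Relation.Unary.Unique.Propositional using (Unique)
  open import Data.List.Membership.Propositional using (_∈_)
  open import Relation.Binary.PropositionalEquality as P using (_≡_; _≢_; sym; trans; cong; cong₂)
  open import Relation.Nullary using (Dec; yes; no; ¬_)
  open import Relation.Binary.Definitions using (DecidableEquality)
  open import Algebra.Bundles using (CommutativeRing)
  import Algebra.Properties.Group
  open import Data.Empty using (⊥-elim)

  open FiniteField 𝔽 public

  powF : Carrier → ℕ → Carrier
  powF = Defs.powF 𝔽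

  natF : ℕ → Carrier
  natF = Defs.natF 𝔽

  card : ℕ
  card = Defs.card 𝔽

  fieldRing : CommutativeRing 0ℓ 0ℓ
  fieldRing = record { isCommutativeRing = isCommutativeRing }

  open CommutativeRing fieldRing public using ()
    renaming (+-assoc to ⊕-assoc; +-comm to ⊕-comm; *-assoc to ⊗-assoc; *-comm to ⊗-comm;
              +-identityˡ to ⊕-idˡ; +-identityʳ to ⊕-idʳ; *-identityˡ to ⊗-idˡ; *-identityʳ to ⊗-idʳ;
              distribˡ to ⊗-distribˡ; distribʳ to ⊗-distribʳ; zeroˡ to ⊗-zeroˡ; zeroʳ to ⊗-zeroʳ;
              -‿inverseˡ to ⊖-invˡ; -‿inverseʳ to ⊖-invʳ)

  module FieldSolver = RingSolver fieldRing
  private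
    module +-group = Algebra.Properties.Group (CommutativeRing.+-group fieldRing)

  private
    ≟-within : ∀ {x y} (xs : List Carrier) → Unique xs → x ∈ xs → y ∈ xs → Dec (x ≡ y)
    ≟-within (a ∷ xs) u (here p) (here q) = yes (trans p (sym q))
    ≟-within (a ∷ xs) (ax ∷ u) (here p) (there q) = no λ x≡y → All.lookup ax q (trans (sym p) x≡y)
    ≟-within (a ∷ xs) (ax ∷ u) (there p) (here q) = no λ x≡y → All.lookup ax p (trans (sym q) (sym x≡y))
    ≟-within (a ∷ xs) (ax ∷ u) (there p) (there q) = ≟-within xs u p q

  _≟_ : DecidableEquality Carrier
  x ≟ y = ≟-within elements elements-unique (elements-complete x) (elements-complete y)

  ⊖-unique : ∀ {x y} → x ⊕ y ≡ 𝟘 → y ≡ ⊖ x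
  ⊖-unique = +-group.inverseʳ-unique _ _

  ⊕-cancelˡ : ∀ {x y z} → x ⊕ y ≡ x ⊕ z → y ≡ z
  ⊕-cancelˡ = +-group.∙-cancelˡ _ _ _

  abstract
    inv : Carrier → Carrier
    inv x with x ≟ 𝟘
    ... | yes _ = 𝟘
    ... | no p = inverse x p

    inv-correct : ∀ x → x ≢ 𝟘 → x ⊗ inv x ≡ 𝟙
    inv-correct x x≢0 with x ≟ 𝟘
    ... | yes p = ⊥-elim (x≢0 p)
    ... | no p = inverse-correct x p

  x⊗y≡𝟘⇒y≡𝟘 : ∀ {x y} → x ≢ 𝟘 → x ⊗ y ≡ 𝟘 → y ≡ 𝟘
  x⊗y≡𝟘⇒y≡𝟘 {x} {y} x≢0 e = begin
    y ≡⟨ sym (⊗-idˡ y) ⟩ 𝟙 ⊗ y ≡⟨ cong (_⊗ y) (sym (inv-correct x x≢0)) ⟩ (x ⊗ inv x) ⊗ y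
    ≡⟨ cong (_⊗ y) (⊗-comm x _) ⟩ (inv x ⊗ x) ⊗ y ≡⟨ ⊗-assoc _ _ _ ⟩ inv x ⊗ (x ⊗ y)
    ≡⟨ cong (inv x ⊗_) e ⟩ inv x ⊗ 𝟘 ≡⟨ ⊗-zeroʳ _ ⟩ 𝟘 ∎
    where open P.≡-Reasoning

  ⊗-nonzero : ∀ {x y} → x ≢ 𝟘 → y ≢ 𝟘 → x ⊗ y ≢ 𝟘
  ⊗-nonzero x≢0 y≢0 e = y≢0 (x⊗y≡𝟘⇒y≡𝟘 x≢0 e)

  𝟙≢𝟘 : 𝟙 ≢ 𝟘
  𝟙≢𝟘 e = 𝟘≢𝟙 (sym e)

  ⊖𝟙≢𝟘 : ⊖ 𝟙 ≢ 𝟘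
  ⊖𝟙≢𝟘 e = 𝟙≢𝟘 (trans (sym (⊕-idʳ 𝟙)) (trans (cong (𝟙 ⊕_) (sym e)) (⊖-invʳ 𝟙)))

  inv-nonzero : ∀ {x} → x ≢ 𝟘 → inv x ≢ 𝟘
  inv-nonzero {x} x≢0 e = 𝟙≢𝟘 (trans (sym (inv-correct x x≢0)) (trans (cong (x ⊗_) e) (⊗-zeroʳ x)))

  inv-unique : ∀ {x y} → x ⊗ y ≡ 𝟙 → y ≡ inv x
  inv-unique {x} {y} e = begin
    y ≡⟨ sym (⊗-idˡ y) ⟩ 𝟙 ⊗ y ≡⟨ cong (_⊗ y) (sym (inv-correct x x≢0)) ⟩ (x ⊗ inv x) ⊗ y
    ≡⟨ cong (_⊗ y) (⊗-comm x _) ⟩ (inv x ⊗ x) ⊗ y ≡⟨ ⊗-assoc _ _ _ ⟩ inv x ⊗ (x ⊗ y)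
    ≡⟨ cong (inv x ⊗_) e ⟩ inv x ⊗ 𝟙 ≡⟨ ⊗-idʳ _ ⟩ inv x ∎
    where
    open P.≡-Reasoning
    x≢0 : x ≢ 𝟘
    x≢0 x≡0 = 𝟙≢𝟘 (trans (sym e) (trans (cong (_⊗ y) x≡0) (⊗-zeroˡ y)))

  inv-⊗ : ∀ {x y} → x ≢ 𝟘 → y ≢ 𝟘 → inv (x ⊗ y) ≡ inv x ⊗ inv y
  inv-⊗ {x} {y} x0 y0 = sym (inv-unique e)
    where
    open P.≡-Reasoning
    open import Algebra.Properties.CommutativeSemigroup (CommutativeRing.*-commutativeSemigroup fieldRing) using (interchange)
    e : (x ⊗ y) ⊗ (inv x ⊗ inv y) ≡ 𝟙
    e = begin
      (x ⊗ y) ⊗ (inv x ⊗ inv y) ≡⟨ interchange x y (inv x) (inv y) ⟩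
      (x ⊗ inv x) ⊗ (y ⊗ inv y) ≡⟨ cong₂ _⊗_ (inv-correct x x0) (inv-correct y y0) ⟩
      𝟙 ⊗ 𝟙 ≡⟨ ⊗-idˡ 𝟙 ⟩ 𝟙 ∎


module ListSum (M : CommutativeMonoid 0ℓ 0ℓ) where

  open import Data.List using (List; []; _∷_; _++_; map; foldr; concatMap; filter)
  open import Data.List.Relation.Unary.Any using (here; there)
  open import Data.List.Relation.Unary.Unique.Propositional using (Unique)
  import Data.List.Relation.Unary.Unique.Propositional.Properties as Unique
  open import Data.List.Membership.Propositional using (_∈_)
  open import Data.List.Membership.Propositional.Properties using (∈-map⁺)
  open import Data.List.Membership.Propositional.Properties.WithK using (unique∧set⇒bag)
  open import Data.List.Relation.Binary.BagAndSetEquality using (∼bag⇒↭)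
  open import Data.List.Relation.Binary.Permutation.Propositional using (_↭_; ↭⇒↭ₛ′)
  import Data.List.Relation.Binary.Permutation.Propositional.Properties as ↭
  import Data.List.Relation.Binary.Permutation.Setoid.Properties as ↭ₛ
  import Data.List.Properties as List
  open import Relation.Binary.PropositionalEquality as P using (_≡_)
  open import Relation.Unary using (Pred; Decidable)
  open import Relation.Nullary using (does)
  open import Data.Bool using (true; false; if_then_else_)
  open import Function using (_∘_; mk⇔)

  open CommutativeMonoid M
  open import Algebra.Properties.CommutativeSemigroup commutativeSemigroup using (interchange)
  open import Relation.Binary.Reasoning.Setoid setoid

  sumL : {A : Set} → List A → (A → Carrier) → Carrier
  sumL xs f = foldr _∙_ ε (map f xs)

  sum-cong : {A : Set} (xs : List A) {f g : A → Carrier} → (∀ x → x ∈ xs → f x ≈ g x) → sumL xs f ≈ sumL xs g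
  sum-cong [] h = refl
  sum-cong (x ∷ xs) h = ∙-cong (h x (here P.refl)) (sum-cong xs (λ y y∈ → h y (there y∈)))

  sum-cong' : {A : Set} (xs : List A) {f g : A → Carrier} → (∀ x → f x ≈ g x) → sumL xs f ≈ sumL xs g
  sum-cong' xs h = sum-cong xs (λ x _ → h x)

  sum-∙ : {A : Set} (xs : List A) (f g : A → Carrier) → sumL xs (λ x → f x ∙ g x) ≈ sumL xs f ∙ sumL xs g
  sum-∙ [] f g = sym (identityˡ ε)
  sum-∙ (x ∷ xs) f g = trans (∙-congˡ (sum-∙ xs f g)) (interchange _ _ _ _)

  sum-ε : {A : Set} (xs : List A) → sumL xs (λ _ → ε) ≈ ε
  sum-ε [] = refl
  sum-ε (x ∷ xs) = trans (identityˡ _) (sum-ε xs)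

  sum-++ : {A : Set} (xs ys : List A) (f : A → Carrier) → sumL (xs ++ ys) f ≈ sumL xs f ∙ sumL ys f
  sum-++ [] ys f = sym (identityˡ _)
  sum-++ (x ∷ xs) ys f = trans (∙-congˡ (sum-++ xs ys f)) (sym (assoc _ _ _))

  sum-map : {A B : Set} (g : A → B) (xs : List A) (f : B → Carrier) → sumL (map g xs) f ≡ sumL xs (f ∘ g)
  sum-map g xs f = P.cong (foldr _∙_ ε) (P.sym (List.map-∘ xs))

  sum-concatMap : {A B : Set} (g : A → List B) (xs : List A) (f : B → Carrier) →
    sumL (concatMap g xs) f ≈ sumL xs (λ x → sumL (g x) f)
  sum-concatMap g [] f = refl
  sum-concatMap g (x ∷ xs) f = trans (sum-++ (g x) (concatMap g xs) f) (∙-congˡ (sum-concatMap g xs f))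

  sum-swap : {A B : Set} (xs : List A) (ys : List B) (f : A → B → Carrier) →
    sumL xs (λ x → sumL ys (f x)) ≈ sumL ys (λ y → sumL xs (λ x → f x y))
  sum-swap [] ys f = sym (sum-ε ys)
  sum-swap (x ∷ xs) ys f = begin
    sumL ys (f x) ∙ sumL xs (λ x → sumL ys (f x)) ≈⟨ ∙-congˡ (sum-swap xs ys f) ⟩
    sumL ys (f x) ∙ sumL ys (λ y → sumL xs (λ x → f x y)) ≈⟨ sym (sum-∙ ys (f x) _) ⟩
    sumL ys (λ y → f x y ∙ sumL xs (λ x → f x y)) ∎

  sum-filter : {A : Set} {Q : Pred A 0ℓ} (Q? : Decidable Q) (xs : List A) (f : A → Carrier) →
    sumL (filter Q? xs) f ≈ sumL xs (λ x → if does (Q? x) then f x else ε)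
  sum-filter Q? [] f = refl
  sum-filter Q? (x ∷ xs) f with does (Q? x)
  ... | true = ∙-congˡ (sum-filter Q? xs f)
  ... | false = trans (sum-filter Q? xs f) (sym (identityˡ _))

  sum-↭ : {A : Set} {xs ys : List A} (f : A → Carrier) → xs ↭ ys → sumL xs f ≈ sumL ys f
  sum-↭ f p = ↭ₛ.foldr-commMonoid setoid isCommutativeMonoid (↭⇒↭ₛ′ isEquivalence (↭.map⁺ f p))

  sum-unique-sameMembers : {A : Set} (xs ys : List A) (f : A → Carrier) → Unique xs → Unique ys →
    (∀ {z} → z ∈ xs → z ∈ ys) → (∀ {z} → z ∈ ys → z ∈ xs) → sumL xs f ≈ sumL ys f
  sum-unique-sameMembers xs ys f uxs uys to from = sum-↭ f (∼bag⇒↭ (unique∧set⇒bag uxs uys (mk⇔ to from)))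

  sum-bij : {A : Set} (xs : List A) (uxs : Unique xs) (cxs : ∀ x → x ∈ xs)
    (σ τ : A → A) → (∀ x → τ (σ x) ≡ x) → (∀ x → σ (τ x) ≡ x) →
    (f : A → Carrier) → sumL xs (f ∘ σ) ≈ sumL xs f
  sum-bij xs uxs cxs σ τ τσ στ f = begin
    sumL xs (f ∘ σ) ≡⟨ P.sym (sum-map σ xs f) ⟩
    sumL (map σ xs) f ≈⟨ sum-unique-sameMembers (map σ xs) xs f σ-unique uxs (λ {z} _ → cxs z) (λ {z} _ → ∈-σ z) ⟩
    sumL xs f ∎
    where
    σ-unique : Unique (map σ xs)
    σ-unique = Unique.map⁺ (λ {x} {y} e → P.trans (P.sym (τσ x)) (P.trans (P.cong τ e) (τσ y))) uxs
    ∈-σ : ∀ z → z ∈ map σ xs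
    ∈-σ z = P.subst (_∈ map σ xs) (στ z) (∈-map⁺ σ (cxs (τ z)))


module RingListSum (CR : CommutativeRing 0ℓ 0ℓ) where

  open import Data.List using (List; []; _∷_; [_])
  open import Data.List.Relation.Unary.Any using (here; there)
  open import Data.List.Relation.Unary.All as All using ([]; _∷_)
  open import Data.List.Relation.Unary.AllPairs using ([]; _∷_)
  open import Data.List.Relation.Unary.Unique.Propositional using (Unique)
  open import Data.List.Membership.Propositional using (_∈_; _∉_)
  import Relation.Binary.PropositionalEquality as P
  open import Relation.Binary.Definitions using (DecidableEquality)
  open import Data.Empty using (⊥-elim)
  open import Data.Bool using (if_then_else_)
  open import Relation.Nullary using (yes; no; does; ¬_)
  import Algebra.Properties.Ring as RP

  open CommutativeRing CR
  open ListSum +-commutativeMonoid public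
  open import Algebra.Properties.CommutativeSemiring.Exp commutativeSemiring public using (_^_; ^-congˡ; ^-homo-*; ^-distrib-*)
  open RP ring public using (-‿distribˡ-*; -‿distribʳ-*; -‿involutive; -‿+-comm; -0#≈0#; -1*x≈-x)

  module Solver = RingSolver CR

  sum-*ˡ : {A : Set} (c : Carrier) (xs : List A) (f : A → Carrier) → c * sumL xs f ≈ sumL xs (λ x → c * f x)
  sum-*ˡ c [] f = zeroʳ c
  sum-*ˡ c (x ∷ xs) f = trans (distribˡ c _ _) (+-congˡ (sum-*ˡ c xs f))

  sum-*ʳ : {A : Set} (c : Carrier) (xs : List A) (f : A → Carrier) → sumL xs f * c ≈ sumL xs (λ x → f x * c)
  sum-*ʳ c xs f = trans (*-comm _ c) (trans (sum-*ˡ c xs f) (sum-cong' xs (λ x → *-comm c (f x))))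

  sum-neg : {A : Set} (xs : List A) (f : A → Carrier) → - sumL xs f ≈ sumL xs (λ x → - f x)
  sum-neg [] f = -0#≈0#
  sum-neg (x ∷ xs) f = trans (sym (-‿+-comm _ _)) (+-congˡ (sum-neg xs f))

  sum-mul : {A B : Set} (xs : List A) (ys : List B) (f : A → Carrier) (g : B → Carrier) →
    sumL xs f * sumL ys g ≈ sumL xs (λ x → sumL ys (λ y → f x * g y))
  sum-mul xs ys f g = trans (sum-*ʳ _ xs f) (sum-cong' xs (λ x → sum-*ˡ (f x) ys g))

  module Indicator {A : Set} (_≟A_ : DecidableEquality A) where
    sum-indicator-∉ : (xs : List A) (y : A) (g : A → Carrier) → y ∉ xs →
      sumL xs (λ x → if does (x ≟A y) then g x else 0#) ≈ 0#
    sum-indicator-∉ [] y g _ = refl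
    sum-indicator-∉ (x ∷ xs) y g y∉ with x ≟A y
    ... | yes e = ⊥-elim (y∉ (here (P.sym e)))
    ... | no _ = trans (+-identityˡ _) (sum-indicator-∉ xs y g (λ p → y∉ (there p)))

    sum-indicator-∈ : (xs : List A) → Unique xs → (y : A) (g : A → Carrier) → y ∈ xs →
      sumL xs (λ x → if does (x ≟A y) then g x else 0#) ≈ g y
    sum-indicator-∈ (x ∷ xs) (ax ∷ u) y g (here y≡x) with x ≟A y
    ... | yes P.refl = trans (+-congˡ (sum-indicator-∉ xs y g (λ p → All.lookup ax p (P.sym y≡x)))) (+-identityʳ _)
    ... | no ne = ⊥-elim (ne (P.sym y≡x))
    sum-indicator-∈ (x ∷ xs) (ax ∷ u) y g (there p) with x ≟A y
    ... | yes P.refl = ⊥-elim (All.lookup ax p P.refl)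
    ... | no _ = trans (+-identityˡ _) (sum-indicator-∈ xs u y g p)


module Polynomial (𝔽 : FiniteField) where

  import Defs as D
  open import Level using (0ℓ)
  open import Data.Nat using (ℕ; zero; suc)
  open import Data.List using ([]; _∷_; [_]; map)
  open import Data.List.Relation.Unary.All using (All; []; _∷_)
  open import Relation.Binary.PropositionalEquality as P using (_≡_; refl; sym; trans; cong; cong₂)
  open import Relation.Nullary using (¬_)
  open import Algebra.Bundles using (CommutativeRing)
  open import Algebra.Structures using (IsCommutativeRing)
  open import Data.Product using (_,_)
  open FieldProperties 𝔽
  open FieldSolver using (solve; _:=_; _:*_; _:+_)

  Pol : Set
  Pol = D.Poly 𝔽
  addP mulP : Pol → Pol → Pol
  addP = D.addP 𝔽
  mulP = D.mulP 𝔽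

  scaleP : Carrier → Pol → Pol
  scaleP = D.scaleP 𝔽

  oneP : Pol
  oneP = D.oneP 𝔽

  negP : Pol → Pol
  negP = map ⊖_

  coeff : Pol → ℕ → Carrier
  coeff [] _ = 𝟘
  coeff (a ∷ f) zero = a
  coeff (a ∷ f) (suc i) = coeff f i

  infix 4 _≈_
  record _≈_ (f g : Pol) : Set where
    constructor mk
    field at : ∀ i → coeff f i ≡ coeff g i
  open _≈_ public

  ≈-refl : ∀ {f} → f ≈ f
  ≈-refl = mk λ i → refl
  ≈-sym : ∀ {f g} → f ≈ g → g ≈ f
  ≈-sym e = mk λ i → sym (at e i)
  ≈-trans : ∀ {f g h} → f ≈ g → g ≈ h → f ≈ h
  ≈-trans e e' = mk λ i → trans (at e i) (at e' i)

  coeff-add : ∀ f g i → coeff (addP f g) i ≡ coeff f i ⊕ coeff g i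
  coeff-add [] g i = sym (⊕-idˡ _)
  coeff-add (a ∷ f) [] i = sym (⊕-idʳ _)
  coeff-add (a ∷ f) (b ∷ g) zero = refl
  coeff-add (a ∷ f) (b ∷ g) (suc i) = coeff-add f g i

  coeff-scale : ∀ c f i → coeff (scaleP c f) i ≡ c ⊗ coeff f i
  coeff-scale c [] i = sym (⊗-zeroʳ c)
  coeff-scale c (a ∷ f) zero = refl
  coeff-scale c (a ∷ f) (suc i) = coeff-scale c f i

  ⊖𝟘 : ⊖ 𝟘 ≡ 𝟘
  ⊖𝟘 = sym (⊖-unique (⊕-idˡ 𝟘))

  coeff-neg : ∀ f i → coeff (negP f) i ≡ ⊖ coeff f i
  coeff-neg [] i = sym ⊖𝟘
  coeff-neg (a ∷ f) zero = refl
  coeff-neg (a ∷ f) (suc i) = coeff-neg f i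

  cons-cong : ∀ {a b f g} → a ≡ b → f ≈ g → (a ∷ f) ≈ (b ∷ g)
  cons-cong {a} {b} {f} {g} e e' = mk h
    where h : ∀ i → coeff (a ∷ f) i ≡ coeff (b ∷ g) i
          h zero = e
          h (suc i) = at e' i

  [𝟘]≈[] : [ 𝟘 ] ≈ []
  [𝟘]≈[] = mk λ { zero → refl ; (suc i) → refl }

  add-cong : ∀ {f f' g g'} → f ≈ f' → g ≈ g' → addP f g ≈ addP f' g'
  add-cong {f} {f'} {g} {g'} e e' = mk λ i → trans (coeff-add f g i) (trans (cong₂ _⊕_ (at e i) (at e' i)) (sym (coeff-add f' g' i)))

  neg-cong : ∀ {f f'} → f ≈ f' → negP f ≈ negP f'
  neg-cong {f} {f'} e = mk λ i → trans (coeff-neg f i) (trans (cong ⊖_ (at e i)) (sym (coeff-neg f' i)))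

  scale-cong : ∀ {c f f'} → f ≈ f' → scaleP c f ≈ scaleP c f'
  scale-cong {c} {f} {f'} e = mk λ i → trans (coeff-scale c f i) (trans (cong (c ⊗_) (at e i)) (sym (coeff-scale c f' i)))

  add-assoc : ∀ f g h → addP (addP f g) h ≈ addP f (addP g h)
  add-assoc f g h = mk λ i → begin
    coeff (addP (addP f g) h) i ≡⟨ coeff-add (addP f g) h i ⟩
    coeff (addP f g) i ⊕ coeff h i ≡⟨ cong (_⊕ coeff h i) (coeff-add f g i) ⟩
    (coeff f i ⊕ coeff g i) ⊕ coeff h i ≡⟨ ⊕-assoc _ _ _ ⟩
    coeff f i ⊕ (coeff g i ⊕ coeff h i) ≡⟨ cong (coeff f i ⊕_) (sym (coeff-add g h i)) ⟩
    coeff f i ⊕ coeff (addP g h) i ≡⟨ sym (coeff-add f (addP g h) i) ⟩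
    coeff (addP f (addP g h)) i ∎
    where open P.≡-Reasoning

  add-comm : ∀ f g → addP f g ≈ addP g f
  add-comm f g = mk λ i → trans (coeff-add f g i) (trans (⊕-comm _ _) (sym (coeff-add g f i)))

  add-idˡ : ∀ f → addP [] f ≈ f
  add-idˡ f = ≈-refl

  add-idʳ : ∀ f → addP f [] ≈ f
  add-idʳ f = mk λ i → trans (coeff-add f [] i) (⊕-idʳ _)

  add-invˡ : ∀ f → addP (negP f) f ≈ []
  add-invˡ f = mk λ i → trans (coeff-add (negP f) f i) (trans (cong (_⊕ coeff f i) (coeff-neg f i)) (⊖-invˡ _))

  add-invʳ : ∀ f → addP f (negP f) ≈ []
  add-invʳ f = mk λ i → trans (coeff-add f (negP f) i) (trans (cong (coeff f i ⊕_) (coeff-neg f i)) (⊖-invʳ _))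

  mul-zeroL : ∀ f g → (∀ i → coeff f i ≡ 𝟘) → mulP f g ≈ []
  mul-zeroL [] g z = ≈-refl
  mul-zeroL (a ∷ f) g z = mk λ i → trans (coeff-add (scaleP a g) (𝟘 ∷ mulP f g) i)
    (trans (cong₂ _⊕_ (trans (coeff-scale a g i) (trans (cong (_⊗ coeff g i) (z 0)) (⊗-zeroˡ _))) (tl i)) (⊕-idˡ 𝟘))
    where
    tl : ∀ i → coeff (𝟘 ∷ mulP f g) i ≡ 𝟘
    tl zero = refl
    tl (suc i) = at (mul-zeroL f g (λ j → z (suc j))) i

  mul-congˡ : ∀ {f f'} g → f ≈ f' → mulP f g ≈ mulP f' g
  mul-congˡ {[]} {f'} g e = ≈-sym (mul-zeroL f' g (λ i → sym (at e i)))
  mul-congˡ {a ∷ f} {[]} g e = mul-zeroL (a ∷ f) g (at e)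
  mul-congˡ {a ∷ f} {a' ∷ f'} g e = add-cong {scaleP a g} {scaleP a' g} (mk λ i → cong (λ c → coeff (scaleP c g) i) (at e 0))
    (cons-cong refl (mul-congˡ {f} {f'} g (mk λ i → at e (suc i))))

  mul-congʳ : ∀ f {g g'} → g ≈ g' → mulP f g ≈ mulP f g'
  mul-congʳ [] e = ≈-refl
  mul-congʳ (a ∷ f) e = add-cong (scale-cong e) (cons-cong refl (mul-congʳ f e))

  mul-distribʳ : ∀ f g h → mulP (addP f g) h ≈ addP (mulP f h) (mulP g h)
  mul-distribʳ [] g h = ≈-refl
  mul-distribʳ (a ∷ f) [] h = ≈-sym (add-idʳ _)
  mul-distribʳ (a ∷ f) (b ∷ g) h = mk λ i → begin
    coeff (addP (scaleP (a ⊕ b) h) (𝟘 ∷ mulP (addP f g) h)) i ≡⟨ coeff-add (scaleP (a ⊕ b) h) (𝟘 ∷ mulP (addP f g) h) i ⟩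
    coeff (scaleP (a ⊕ b) h) i ⊕ coeff (𝟘 ∷ mulP (addP f g) h) i ≡⟨ cong₂ _⊕_ (coeff-scale (a ⊕ b) h i) (tl i) ⟩
    (a ⊕ b) ⊗ coeff h i ⊕ (coeff (𝟘 ∷ mulP f h) i ⊕ coeff (𝟘 ∷ mulP g h) i)
      ≡⟨ solve 5 (λ a b h x y → (a :+ b) :* h :+ (x :+ y) := (a :* h :+ x) :+ (b :* h :+ y)) refl a b (coeff h i) (coeff (𝟘 ∷ mulP f h) i) (coeff (𝟘 ∷ mulP g h) i) ⟩
    (a ⊗ coeff h i ⊕ coeff (𝟘 ∷ mulP f h) i) ⊕ (b ⊗ coeff h i ⊕ coeff (𝟘 ∷ mulP g h) i)
      ≡⟨ sym (cong₂ _⊕_ (trans (coeff-add (scaleP a h) (𝟘 ∷ mulP f h) i) (cong (_⊕ coeff (𝟘 ∷ mulP f h) i) (coeff-scale a h i))) (trans (coeff-add (scaleP b h) (𝟘 ∷ mulP g h) i) (cong (_⊕ coeff (𝟘 ∷ mulP g h) i) (coeff-scale b h i)))) ⟩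
    coeff (mulP (a ∷ f) h) i ⊕ coeff (mulP (b ∷ g) h) i ≡⟨ sym (coeff-add (mulP (a ∷ f) h) (mulP (b ∷ g) h) i) ⟩
    coeff (addP (mulP (a ∷ f) h) (mulP (b ∷ g) h)) i ∎
    where
    open P.≡-Reasoning
    tl : ∀ i → coeff (𝟘 ∷ mulP (addP f g) h) i ≡ coeff (𝟘 ∷ mulP f h) i ⊕ coeff (𝟘 ∷ mulP g h) i
    tl zero = sym (⊕-idˡ 𝟘)
    tl (suc i) = trans (at (mul-distribʳ f g h) i) (coeff-add (mulP f h) (mulP g h) i)

  mul-scale : ∀ a g h → mulP (scaleP a g) h ≈ scaleP a (mulP g h)
  mul-scale a [] h = ≈-refl
  mul-scale a (b ∷ g) h = mk λ i → begin
    coeff (addP (scaleP (a ⊗ b) h) (𝟘 ∷ mulP (scaleP a g) h)) i ≡⟨ coeff-add (scaleP (a ⊗ b) h) (𝟘 ∷ mulP (scaleP a g) h) i ⟩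
    coeff (scaleP (a ⊗ b) h) i ⊕ coeff (𝟘 ∷ mulP (scaleP a g) h) i ≡⟨ cong₂ _⊕_ (coeff-scale (a ⊗ b) h i) (tl i) ⟩
    (a ⊗ b) ⊗ coeff h i ⊕ a ⊗ coeff (𝟘 ∷ mulP g h) i
      ≡⟨ solve 4 (λ a b h x → (a :* b) :* h :+ a :* x := a :* (b :* h :+ x)) refl a b (coeff h i) (coeff (𝟘 ∷ mulP g h) i) ⟩
    a ⊗ (b ⊗ coeff h i ⊕ coeff (𝟘 ∷ mulP g h) i) ≡⟨ cong (a ⊗_) (sym (trans (coeff-add (scaleP b h) (𝟘 ∷ mulP g h) i) (cong (_⊕ coeff (𝟘 ∷ mulP g h) i) (coeff-scale b h i)))) ⟩
    a ⊗ coeff (mulP (b ∷ g) h) i ≡⟨ sym (coeff-scale a (mulP (b ∷ g) h) i) ⟩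
    coeff (scaleP a (mulP (b ∷ g) h)) i ∎
    where
    open P.≡-Reasoning
    tl : ∀ i → coeff (𝟘 ∷ mulP (scaleP a g) h) i ≡ a ⊗ coeff (𝟘 ∷ mulP g h) i
    tl zero = sym (⊗-zeroʳ a)
    tl (suc i) = trans (at (mul-scale a g h) i) (coeff-scale a (mulP g h) i)

  mul-shift : ∀ f g → mulP (𝟘 ∷ f) g ≈ (𝟘 ∷ mulP f g)
  mul-shift f g = mk λ i → trans (coeff-add (scaleP 𝟘 g) (𝟘 ∷ mulP f g) i) (trans (cong (_⊕ coeff (𝟘 ∷ mulP f g) i) (trans (coeff-scale 𝟘 g i) (⊗-zeroˡ (coeff g i)))) (⊕-idˡ (coeff (𝟘 ∷ mulP f g) i)))

  mul-assoc : ∀ f g h → mulP (mulP f g) h ≈ mulP f (mulP g h)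
  mul-assoc [] g h = ≈-refl
  mul-assoc (a ∷ f) g h =
    ≈-trans (mul-distribʳ (scaleP a g) (𝟘 ∷ mulP f g) h)
    (add-cong (mul-scale a g h) (≈-trans (mul-shift (mulP f g) h) (cons-cong refl (mul-assoc f g h))))

  mul-nilʳ : ∀ f → mulP f [] ≈ []
  mul-nilʳ [] = ≈-refl
  mul-nilʳ (a ∷ f) = mk h
    where h : ∀ i → coeff (mulP (a ∷ f) []) i ≡ 𝟘
          h zero = refl
          h (suc i) = at (mul-nilʳ f) i

  mul-consʳ : ∀ f b g → mulP f (b ∷ g) ≈ addP (scaleP b f) (𝟘 ∷ mulP f g)
  mul-consʳ [] b g = mk h
    where h : ∀ i → coeff (mulP [] (b ∷ g)) i ≡ coeff (addP (scaleP b []) (𝟘 ∷ mulP [] g)) i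
          h zero = refl
          h (suc i) = refl
  mul-consʳ (a ∷ f) b g = mk h
    where
    open P.≡-Reasoning
    h : ∀ i → coeff (mulP (a ∷ f) (b ∷ g)) i ≡ coeff (addP (scaleP b (a ∷ f)) (𝟘 ∷ mulP (a ∷ f) g)) i
    h zero = trans (⊕-idʳ _) (trans (⊗-comm a b) (sym (⊕-idʳ _)))
    h (suc i) = begin
      coeff (addP (scaleP a g) (mulP f (b ∷ g))) i ≡⟨ at (add-cong (≈-refl {scaleP a g}) (mul-consʳ f b g)) i ⟩
      coeff (addP (scaleP a g) (addP (scaleP b f) (𝟘 ∷ mulP f g))) i ≡⟨ sym (at (add-assoc (scaleP a g) _ _) i) ⟩
      coeff (addP (addP (scaleP a g) (scaleP b f)) (𝟘 ∷ mulP f g)) i ≡⟨ at (add-cong (add-comm (scaleP a g) _) (≈-refl {𝟘 ∷ mulP f g})) i ⟩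
      coeff (addP (addP (scaleP b f) (scaleP a g)) (𝟘 ∷ mulP f g)) i ≡⟨ at (add-assoc (scaleP b f) _ _) i ⟩
      coeff (addP (scaleP b f) (addP (scaleP a g) (𝟘 ∷ mulP f g))) i ∎

  mul-comm : ∀ f g → mulP f g ≈ mulP g f
  mul-comm [] g = ≈-sym (mul-nilʳ g)
  mul-comm (a ∷ f) g = ≈-trans (add-cong (≈-refl {scaleP a g}) (cons-cong refl (mul-comm f g))) (≈-sym (mul-consʳ g a f))

  mul-idˡ : ∀ f → mulP oneP f ≈ f
  mul-idˡ f = mk λ i → trans (coeff-add (scaleP 𝟙 f) _ i) (trans (cong₂ _⊕_ (trans (coeff-scale 𝟙 f i) (⊗-idˡ _)) (at [𝟘]≈[] i)) (⊕-idʳ _))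

  mulP-singleton : ∀ a g → mulP [ a ] g ≈ scaleP a g
  mulP-singleton a g = mk λ i → trans (coeff-add (scaleP a g) (𝟘 ∷ []) i) (trans (cong (coeff (scaleP a g) i ⊕_) (at [𝟘]≈[] i)) (⊕-idʳ _))

  mul-distribˡ : ∀ f g h → mulP f (addP g h) ≈ addP (mulP f g) (mulP f h)
  mul-distribˡ f g h = ≈-trans (mul-comm f _) (≈-trans (mul-distribʳ g h f) (add-cong (mul-comm g f) (mul-comm h f)))

  polyIsCommutativeRing : IsCommutativeRing _≈_ addP mulP negP [] oneP
  polyIsCommutativeRing = record
    { isRing = record
      { +-isAbelianGroup = record
        { isGroup = record
          { isMonoid = record
            { isSemigroup = record
              { isMagma = record
                { isEquivalence = record { refl = ≈-refl ; sym = ≈-sym ; trans = ≈-trans }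
                ; ∙-cong = add-cong }
              ; assoc = add-assoc }
            ; identity = add-idˡ , add-idʳ }
          ; inverse = add-invˡ , add-invʳ
          ; ⁻¹-cong = neg-cong }
        ; comm = add-comm }
      ; *-cong = λ {f} {f'} {g} {g'} e e' → ≈-trans (mul-congˡ g e) (mul-congʳ f' e')
      ; *-assoc = mul-assoc
      ; *-identity = mul-idˡ , (λ f → ≈-trans (mul-comm f oneP) (mul-idˡ f))
      ; distrib = mul-distribˡ , (λ h f g → mul-distribʳ f g h) }
    ; *-comm = mul-comm }

  polyRing : CommutativeRing 0ℓ 0ℓ
  polyRing = record { isCommutativeRing = polyIsCommutativeRing }

  allZero : ∀ h → (∀ i → coeff h i ≡ 𝟘) → All (_≡ 𝟘) h
  allZero [] z = []
  allZero (a ∷ h) z = z 0 ∷ allZero h (λ i → z (suc i))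

  ≈⇒≈P : ∀ {f g} → f ≈ g → D._≈P_ 𝔽 f g
  ≈⇒≈P {f} {g} e = allZero (addP f (negP g)) (λ i → trans (coeff-add f (negP g) i) (trans (cong (coeff f i ⊕_) (coeff-neg g i)) (trans (cong (λ c → coeff f i ⊕ ⊖ c) (sym (at e i))) (⊖-invʳ _))))


module Cancellation (𝔽 : FiniteField) where

  open import Data.Nat using (ℕ; zero; suc; _≤_; _+_; s≤s)
  import Data.Nat.Properties as ℕP
  open import Data.List using ([]; _∷_; _++_; [_]; length; replicate)
  open import Data.List.Base using (initLast; _∷ʳ′_)
  import Data.List.Properties as LP
  open import Data.List.Relation.Unary.All as All using (All; []; _∷_)
  open import Relation.Binary.PropositionalEquality as P using (_≡_; _≢_; refl; sym; trans; cong; cong₂; subst)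
  open import Relation.Nullary using (Dec; yes; no; ¬_)
  open import Data.Product using (_×_; _,_; Σ)
  open import Data.Empty using (⊥-elim)
  open FieldProperties 𝔽
  open Polynomial 𝔽

  coeff-beyond : ∀ f i → length f ≤ i → coeff f i ≡ 𝟘
  coeff-beyond [] i _ = refl
  coeff-beyond (a ∷ f) (suc i) (s≤s le) = coeff-beyond f i le

  coeff-mul-beyond : ∀ f g i → length f + length g ≤ suc i → coeff (mulP f g) i ≡ 𝟘
  coeff-mul-beyond [] g i _ = refl
  coeff-mul-beyond (a ∷ f) g i (s≤s le) = begin
    coeff (addP (scaleP a g) (𝟘 ∷ mulP f g)) i ≡⟨ coeff-add (scaleP a g) (𝟘 ∷ mulP f g) i ⟩
    coeff (scaleP a g) i ⊕ coeff (𝟘 ∷ mulP f g) i ≡⟨ cong₂ _⊕_ (trans (coeff-scale a g i) (trans (cong (a ⊗_) (coeff-beyond g i (ℕP.≤-trans (ℕP.m≤n+m _ _) le))) (⊗-zeroʳ a))) (tl i le) ⟩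
    𝟘 ⊕ 𝟘 ≡⟨ ⊕-idˡ 𝟘 ⟩
    𝟘 ∎
    where
    open P.≡-Reasoning
    tl : ∀ i → length f + length g ≤ i → coeff (𝟘 ∷ mulP f g) i ≡ 𝟘
    tl zero _ = refl
    tl (suc i) le = coeff-mul-beyond f g i le

  coeff-replicate-++ : ∀ n g k → coeff (replicate n 𝟘 ++ g) (n + k) ≡ coeff g k
  coeff-replicate-++ zero g k = refl
  coeff-replicate-++ (suc n) g k = coeff-replicate-++ n g k

  coeff-last : ∀ D' γ → coeff (D' ++ [ γ ]) (length D') ≡ γ
  coeff-last [] γ = refl
  coeff-last (a ∷ D') γ = coeff-last D' γ

  ∷ʳ-𝟘 : ∀ f → (f ++ [ 𝟘 ]) ≈ f
  ∷ʳ-𝟘 [] = [𝟘]≈[]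
  ∷ʳ-𝟘 (a ∷ f) = cons-cong refl (∷ʳ-𝟘 f)

  𝟘∷-addP : ∀ X Y → (𝟘 ∷ addP X Y) ≈ addP (𝟘 ∷ X) (𝟘 ∷ Y)
  𝟘∷-addP X Y = cons-cong (sym (⊕-idˡ 𝟘)) ≈-refl

  mulP-∷ʳ : ∀ f c E → mulP (f ++ [ c ]) E ≈ addP (mulP f E) (replicate (length f) 𝟘 ++ scaleP c E)
  mulP-∷ʳ [] c E = add-idʳ' 
    where
    add-idʳ' : addP (scaleP c E) (𝟘 ∷ []) ≈ scaleP c E
    add-idʳ' = ≈-trans (add-cong (≈-refl {scaleP c E}) [𝟘]≈[]) (add-idʳ (scaleP c E))
  mulP-∷ʳ (a ∷ f) c E =
    ≈-trans (add-cong (≈-refl {scaleP a E}) (cons-cong refl (mulP-∷ʳ f c E)))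
    (≈-trans (add-cong (≈-refl {scaleP a E}) (𝟘∷-addP (mulP f E) (replicate (length f) 𝟘 ++ scaleP c E)))
    (≈-sym (add-assoc (scaleP a E) (𝟘 ∷ mulP f E) (𝟘 ∷ (replicate (length f) 𝟘 ++ scaleP c E)))))

  Cancellable : Pol → Set
  Cancellable d = ∀ f → mulP f d ≈ [] → f ≈ []

  length-∷ʳ : ∀ (f : Pol) c → length (f ++ [ c ]) ≡ suc (length f)
  length-∷ʳ f c = trans (LP.length-++ f) (ℕP.+-comm (length f) 1)

  coeff-top-mulP-∷ʳ : ∀ f c D' γ → coeff (mulP (f ++ [ c ]) (D' ++ [ γ ])) (length f + length D') ≡ c ⊗ γ
  coeff-top-mulP-∷ʳ f c D' γ = begin
    coeff (mulP (f ++ [ c ]) D) k ≡⟨ at (mulP-∷ʳ f c D) k ⟩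
    coeff (addP (mulP f D) (replicate (length f) 𝟘 ++ scaleP c D)) k ≡⟨ coeff-add (mulP f D) _ k ⟩
    coeff (mulP f D) k ⊕ coeff (replicate (length f) 𝟘 ++ scaleP c D) k
      ≡⟨ cong (_⊕ coeff (replicate (length f) 𝟘 ++ scaleP c D) k) (coeff-mul-beyond f D k (ℕP.≤-reflexive (trans (cong (length f +_) (length-∷ʳ D' γ)) (ℕP.+-suc (length f) (length D'))))) ⟩
    𝟘 ⊕ coeff (replicate (length f) 𝟘 ++ scaleP c D) k ≡⟨ ⊕-idˡ _ ⟩
    coeff (replicate (length f) 𝟘 ++ scaleP c D) k ≡⟨ coeff-replicate-++ (length f) (scaleP c D) (length D') ⟩
    coeff (scaleP c D) (length D') ≡⟨ coeff-scale c D (length D') ⟩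
    c ⊗ coeff D (length D') ≡⟨ cong (c ⊗_) (coeff-last D' γ) ⟩
    c ⊗ γ ∎
    where
    open P.≡-Reasoning
    D : Pol
    D = D' ++ [ γ ]
    k : ℕ
    k = length f + length D'

  private
    cancellable-∷ʳ-bounded : ∀ D' γ → γ ≢ 𝟘 → ∀ n f → length f ≤ n → mulP f (D' ++ [ γ ]) ≈ [] → f ≈ []
    cancellable-∷ʳ-bounded D' γ γ≢0 n f le e with initLast f
    ... | [] = ≈-refl
    cancellable-∷ʳ-bounded D' γ γ≢0 zero f le e | f' ∷ʳ′ c with subst (_≤ 0) (length-∷ʳ f' c) le
    ... | ()
    cancellable-∷ʳ-bounded D' γ γ≢0 (suc n) f le e | f' ∷ʳ′ c = ≈-trans f≈f' f'≈0
      where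
      c≡0 : c ≡ 𝟘
      c≡0 = x⊗y≡𝟘⇒y≡𝟘 γ≢0 (trans (⊗-comm γ c) (trans (sym (coeff-top-mulP-∷ʳ f' c D' γ)) (at e _)))
      f≈f' : (f' ++ [ c ]) ≈ f'
      f≈f' rewrite c≡0 = ∷ʳ-𝟘 f'
      f'≈0 : f' ≈ []
      f'≈0 = cancellable-∷ʳ-bounded D' γ γ≢0 n f' (ℕP.≤-pred (subst (_≤ suc n) (length-∷ʳ f' c) le))
               (≈-trans (mul-congˡ (D' ++ [ γ ]) (≈-sym f≈f')) e)

  cancellable-∷ʳ : ∀ D' γ → γ ≢ 𝟘 → Cancellable (D' ++ [ γ ])
  cancellable-∷ʳ D' γ γ≢0 f e = cancellable-∷ʳ-bounded D' γ γ≢0 (length f) f ℕP.≤-refl e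

  cancellable-resp-≈ : ∀ {d d'} → d ≈ d' → Cancellable d → Cancellable d'
  cancellable-resp-≈ e g f e' = g f (≈-trans (mul-congʳ f e) e')

  cancellable-* : ∀ {d e} → Cancellable d → Cancellable e → Cancellable (mulP d e)
  cancellable-* {d} {e} gd ge f h = gd f (ge (mulP f d) (≈-trans (mul-assoc f d e) h))

  cancellable-one : Cancellable oneP
  cancellable-one = cancellable-∷ʳ [] 𝟙 𝟙≢𝟘

  zero? : ∀ t → Dec (All (_≡ 𝟘) t)
  zero? t = All.all? (λ x → x ≟ 𝟘) t

  allZ⇒≈ : ∀ {t} → All (_≡ 𝟘) t → t ≈ []
  allZ⇒≈ [] = ≈-refl
  allZ⇒≈ {a ∷ t} (p ∷ ps) = mk h
    where h : ∀ i → coeff (a ∷ t) i ≡ coeff [] i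
          h zero = p
          h (suc i) = at (allZ⇒≈ ps) i

  ≈⇒allZ : ∀ {t} → t ≈ [] → All (_≡ 𝟘) t
  ≈⇒allZ {t} e = allZero t (at e)

  leading-term : ∀ t → ¬ All (_≡ 𝟘) t → Σ Pol λ t' → Σ Carrier λ γ → γ ≢ 𝟘 × t ≈ (t' ++ [ γ ])
  leading-term [] nz = ⊥-elim (nz [])
  leading-term (a ∷ t) nz with zero? t
  ... | yes z = [] , a , (λ a≡0 → nz (a≡0 ∷ z)) , cons-cong refl (allZ⇒≈ z)
  ... | no nz' with leading-term t nz'
  ...   | t' , γ , γ≢0 , e = (a ∷ t') , γ , γ≢0 , cons-cong refl e

  cancellable-nonzero : ∀ t → ¬ All (_≡ 𝟘) t → Cancellable t
  cancellable-nonzero t nz with leading-term t nz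
  ... | t' , γ , γ≢0 , e = cancellable-resp-≈ (≈-sym e) (cancellable-∷ʳ t' γ γ≢0)


module Fraction (𝔽 : FiniteField) where

  import Defs as D
  open import Level using (0ℓ)
  open import Data.List using ([]; _∷_; [_])
  open import Data.Product using (_,_)
  open import Algebra.Bundles using (CommutativeRing)
  open import Algebra.Structures using (IsCommutativeRing)
  open Polynomial 𝔽 using (Pol; oneP; polyRing; ≈⇒≈P)
  open Cancellation 𝔽 using (Cancellable; cancellable-*; cancellable-one)
  import Algebra.Properties.Group as GP

  module PR = CommutativeRing polyRing
  open PR using () renaming (_≈_ to _≈p_; _+_ to _+p_; _*_ to _*p_; -_ to -p_)
  module PS = RingListSum polyRing
  open PS.Solver using (solve; _:=_; _:*_; _:+_)
  open import Relation.Binary.Reasoning.Setoid PR.setoid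

  Frac : Set
  Frac = D.Frac 𝔽

  -- k is modelled by fractions with cancellable denominators, compared by cross-multiplication as in Defs._≈k_.
  record K : Set where
    constructor _/_[_]
    field
      num : Pol
      den : Pol
      den-cancellable : Cancellable den
  open K public

  frac : K → Frac
  frac x = num x , den x

  infix 4 _≃'_ _≃_
  _≃'_ : K → K → Set
  x ≃' y = (num x *p den y) ≈p (num y *p den x)

  record _≃_ (x y : K) : Set where
    constructor mk≃
    field prf : x ≃' y
  open _≃_ public

  _+k_ : K → K → K
  x +k y = (num x *p den y +p num y *p den x) / (den x *p den y) [ cancellable-* (den-cancellable x) (den-cancellable y) ]

  _*k_ : K → K → K
  x *k y = (num x *p num y) / (den x *p den y) [ cancellable-* (den-cancellable x) (den-cancellable y) ]

  -k_ : K → K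
  -k x = (-p num x) / den x [ den-cancellable x ]

  0k 1k : K
  0k = [] / oneP [ cancellable-one ]
  1k = oneP / oneP [ cancellable-one ]

  private
    module G = GP PR.+-group
    open PR

    ≃-refl : ∀ {x} → x ≃' x
    ≃-refl = refl

    ≃-sym : ∀ {x y} → x ≃' y → y ≃' x
    ≃-sym e = sym e

    ≃-trans : ∀ {x y z} → x ≃' y → y ≃' z → x ≃' z
    ≃-trans {n1 / d1 [ g1 ]} {n2 / d2 [ g2 ]} {n3 / d3 [ g3 ]} e1 e2 =
      G.x∙y⁻¹≈ε⇒x≈y _ _ (g2 _ (begin
        (n1 * d3 + - (n3 * d1)) * d2 ≈⟨ distribʳ d2 (n1 * d3) (- (n3 * d1)) ⟩
        n1 * d3 * d2 + - (n3 * d1) * d2 ≈⟨ +-congˡ {n1 * d3 * d2} (PS.-‿distribˡ-* (n3 * d1) d2) ⟨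
        n1 * d3 * d2 + - (n3 * d1 * d2) ≈⟨ +-cong (swap₂₃ n1 d3 d2) (-‿cong (swap₂₃ n3 d1 d2)) ⟩
        n1 * d2 * d3 + - (n3 * d2 * d1) ≈⟨ +-cong (*-congʳ e1) (-‿cong (*-congʳ (sym e2))) ⟩
        n2 * d1 * d3 + - (n2 * d3 * d1) ≈⟨ +-congˡ {n2 * d1 * d3} (-‿cong (swap₂₃ n2 d3 d1)) ⟩
        n2 * d1 * d3 + - (n2 * d1 * d3) ≈⟨ -‿inverseʳ (n2 * d1 * d3) ⟩
        0# ∎))
      where
      swap₂₃ : ∀ a b c → a * b * c ≈ a * c * b
      swap₂₃ = solve 3 (λ a b c → a :* b :* c := a :* c :* b) refl

    +-cong' : ∀ {x x' y y'} → x ≃' x' → y ≃' y' → (x +k y) ≃' (x' +k y')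
    +-cong' {n1 / d1 [ _ ]} {n1' / d1' [ _ ]} {n2 / d2 [ _ ]} {n2' / d2' [ _ ]} e1 e2 = begin
      (n1 * d2 + n2 * d1) * (d1' * d2') ≈⟨ expand n1 d2 n2 d1 d1' d2' ⟩
      (n1 * d1') * (d2 * d2') + (n2 * d2') * (d1 * d1') ≈⟨ +-cong (*-congʳ e1) (*-congʳ e2) ⟩
      (n1' * d1) * (d2 * d2') + (n2' * d2) * (d1 * d1') ≈⟨ collect n1' d2' n2' d1' d1 d2 ⟩
      (n1' * d2' + n2' * d1') * (d1 * d2) ∎
      where
      expand : ∀ n1 d2 n2 d1 d1' d2' → (n1 * d2 + n2 * d1) * (d1' * d2') ≈ (n1 * d1') * (d2 * d2') + (n2 * d2') * (d1 * d1')
      expand = solve 6 (λ n1 d2 n2 d1 d1' d2' → (n1 :* d2 :+ n2 :* d1) :* (d1' :* d2') := (n1 :* d1') :* (d2 :* d2') :+ (n2 :* d2') :* (d1 :* d1')) refl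
      collect : ∀ n1' d2' n2' d1' d1 d2 → (n1' * d1) * (d2 * d2') + (n2' * d2) * (d1 * d1') ≈ (n1' * d2' + n2' * d1') * (d1 * d2)
      collect = solve 6 (λ n1' d2' n2' d1' d1 d2 → (n1' :* d1) :* (d2 :* d2') :+ (n2' :* d2) :* (d1 :* d1') := (n1' :* d2' :+ n2' :* d1') :* (d1 :* d2)) refl

    *-cong' : ∀ {x x' y y'} → x ≃' x' → y ≃' y' → (x *k y) ≃' (x' *k y')
    *-cong' {n1 / d1 [ _ ]} {n1' / d1' [ _ ]} {n2 / d2 [ _ ]} {n2' / d2' [ _ ]} e1 e2 = begin
      (n1 * n2) * (d1' * d2') ≈⟨ interchange n1 n2 d1' d2' ⟩
      (n1 * d1') * (n2 * d2') ≈⟨ *-cong e1 e2 ⟩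
      (n1' * d1) * (n2' * d2) ≈⟨ interchange n1' d1 n2' d2 ⟩
      (n1' * n2') * (d1 * d2) ∎
      where open import Algebra.Properties.CommutativeSemigroup *-commutativeSemigroup using (interchange)

    neg-cong' : ∀ {x x'} → x ≃' x' → (-k x) ≃' (-k x')
    neg-cong' {n1 / d1 [ _ ]} {n1' / d1' [ _ ]} e = begin
      - n1 * d1' ≈⟨ PS.-‿distribˡ-* n1 d1' ⟨
      - (n1 * d1') ≈⟨ -‿cong e ⟩
      - (n1' * d1) ≈⟨ PS.-‿distribˡ-* n1' d1 ⟩
      - n1' * d1 ∎

    +-assoc' : ∀ x y z → ((x +k y) +k z) ≃' (x +k (y +k z))
    +-assoc' (n1 / d1 [ _ ]) (n2 / d2 [ _ ]) (n3 / d3 [ _ ]) =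
      solve 6 (λ n1 d1 n2 d2 n3 d3 → ((n1 :* d2 :+ n2 :* d1) :* d3 :+ n3 :* (d1 :* d2)) :* (d1 :* (d2 :* d3)) := (n1 :* (d2 :* d3) :+ (n2 :* d3 :+ n3 :* d2) :* d1) :* ((d1 :* d2) :* d3)) refl n1 d1 n2 d2 n3 d3

    +-comm' : ∀ x y → (x +k y) ≃' (y +k x)
    +-comm' (n1 / d1 [ _ ]) (n2 / d2 [ _ ]) =
      solve 4 (λ n1 d1 n2 d2 → (n1 :* d2 :+ n2 :* d1) :* (d2 :* d1) := (n2 :* d1 :+ n1 :* d2) :* (d1 :* d2)) refl n1 d1 n2 d2

    +-idˡ' : ∀ x → (0k +k x) ≃' x
    +-idˡ' (n / d [ _ ]) = begin
      ([] * d + n * oneP) * d ≈⟨ *-congʳ {d} (+-congʳ {n * oneP} (zeroˡ d)) ⟩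
      (0# + n * oneP) * d ≈⟨ solve 2 (λ n d → (PS.Solver.con 0 :+ n :* PS.Solver.con 1) :* d := n :* (PS.Solver.con 1 :* d)) refl n d ⟩
      n * (oneP * d) ∎

    +-idʳ' : ∀ x → (x +k 0k) ≃' x
    +-idʳ' x = ≃-trans {x +k 0k} {0k +k x} {x} (+-comm' x 0k) (+-idˡ' x)

    +-invˡ' : ∀ x → ((-k x) +k x) ≃' 0k
    +-invˡ' (n / d [ _ ]) = begin
      (- n * d + n * d) * oneP ≈⟨ *-congʳ {oneP} (+-congʳ {n * d} (sym (PS.-‿distribˡ-* n d))) ⟩
      (- (n * d) + n * d) * oneP ≈⟨ *-congʳ {oneP} (-‿inverseˡ (n * d)) ⟩
      0# * oneP ≈⟨ zeroˡ oneP ⟩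
      0# ≈⟨ zeroˡ (d * d) ⟨
      [] * (d * d) ∎

    +-invʳ' : ∀ x → (x +k (-k x)) ≃' 0k
    +-invʳ' x = ≃-trans {x +k (-k x)} {(-k x) +k x} {0k} (+-comm' x (-k x)) (+-invˡ' x)

    *-assoc' : ∀ x y z → ((x *k y) *k z) ≃' (x *k (y *k z))
    *-assoc' (n1 / d1 [ _ ]) (n2 / d2 [ _ ]) (n3 / d3 [ _ ]) =
      solve 6 (λ n1 d1 n2 d2 n3 d3 → ((n1 :* n2) :* n3) :* (d1 :* (d2 :* d3)) := (n1 :* (n2 :* n3)) :* ((d1 :* d2) :* d3)) refl n1 d1 n2 d2 n3 d3

    *-comm' : ∀ x y → (x *k y) ≃' (y *k x)
    *-comm' (n1 / d1 [ _ ]) (n2 / d2 [ _ ]) =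
      solve 4 (λ n1 d1 n2 d2 → (n1 :* n2) :* (d2 :* d1) := (n2 :* n1) :* (d1 :* d2)) refl n1 d1 n2 d2

    *-idˡ' : ∀ x → (1k *k x) ≃' x
    *-idˡ' (n / d [ _ ]) = solve 3 (λ o n d → (o :* n) :* d := n :* (o :* d)) refl oneP n d

    *-idʳ' : ∀ x → (x *k 1k) ≃' x
    *-idʳ' x = ≃-trans {x *k 1k} {1k *k x} {x} (*-comm' x 1k) (*-idˡ' x)

    distribˡ' : ∀ x y z → (x *k (y +k z)) ≃' ((x *k y) +k (x *k z))
    distribˡ' (n1 / d1 [ _ ]) (n2 / d2 [ _ ]) (n3 / d3 [ _ ]) =
      solve 6 (λ n1 d1 n2 d2 n3 d3 → (n1 :* (n2 :* d3 :+ n3 :* d2)) :* ((d1 :* d2) :* (d1 :* d3)) := ((n1 :* n2) :* (d1 :* d3) :+ (n1 :* n3) :* (d1 :* d2)) :* (d1 :* (d2 :* d3))) refl n1 d1 n2 d2 n3 d3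

    distribʳ' : ∀ x y z → ((y +k z) *k x) ≃' ((y *k x) +k (z *k x))
    distribʳ' (n1 / d1 [ _ ]) (n2 / d2 [ _ ]) (n3 / d3 [ _ ]) =
      solve 6 (λ n1 d1 n2 d2 n3 d3 → ((n2 :* d3 :+ n3 :* d2) :* n1) :* ((d2 :* d1) :* (d3 :* d1)) := ((n2 :* n1) :* (d3 :* d1) :+ (n3 :* n1) :* (d2 :* d1)) :* ((d2 :* d3) :* d1)) refl n1 d1 n2 d2 n3 d3

  fracIsCommutativeRing : IsCommutativeRing _≃_ _+k_ _*k_ -k_ 0k 1k
  fracIsCommutativeRing = record
    { isRing = record
      { +-isAbelianGroup = record
        { isGroup = record
          { isMonoid = record
            { isSemigroup = record
              { isMagma = record
                { isEquivalence = record { refl = λ {x} → mk≃ (≃-refl {x}) ; sym = λ {x} {y} e → mk≃ (≃-sym {x} {y} (prf e)) ; trans = λ {x} {y} {z} e e' → mk≃ (≃-trans {x} {y} {z} (prf e) (prf e')) }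
                ; ∙-cong = λ {x} {x'} {y} {y'} e e' → mk≃ (+-cong' {x} {x'} {y} {y'} (prf e) (prf e')) }
              ; assoc = λ x y z → mk≃ (+-assoc' x y z) }
            ; identity = (λ x → mk≃ (+-idˡ' x)) , (λ x → mk≃ (+-idʳ' x)) }
          ; inverse = (λ x → mk≃ (+-invˡ' x)) , (λ x → mk≃ (+-invʳ' x))
          ; ⁻¹-cong = λ {x} {x'} e → mk≃ (neg-cong' {x} {x'} (prf e)) }
        ; comm = λ x y → mk≃ (+-comm' x y) }
      ; *-cong = λ {x} {x'} {y} {y'} e e' → mk≃ (*-cong' {x} {x'} {y} {y'} (prf e) (prf e'))
      ; *-assoc = λ x y z → mk≃ (*-assoc' x y z)
      ; *-identity = (λ x → mk≃ (*-idˡ' x)) , (λ x → mk≃ (*-idʳ' x))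
      ; distrib = (λ x y z → mk≃ (distribˡ' x y z)) , (λ x y z → mk≃ (distribʳ' x y z)) }
    ; *-comm = λ x y → mk≃ (*-comm' x y) }

  fracRing : CommutativeRing 0ℓ 0ℓ
  fracRing = record { isCommutativeRing = fracIsCommutativeRing }

  ≃⇒≈k : ∀ {x y} → x ≃ y → D._≈k_ 𝔽 (frac x) (frac y)
  ≃⇒≈k e = ≈⇒≈P (prf e)


module PowerSums (𝔽 : FiniteField) where

  open import Data.Nat as ℕ using (ℕ; zero; suc; _≤_; _<_; _∸_) renaming (_+_ to _+ℕ_; _*_ to _*ℕ_)
  import Data.Nat.Properties as ℕP
  open import Data.Nat.DivMod using (_%_; _/_; m≡m%n+[m/n]*n; m%n<n)
  open import Data.Nat.Divisibility using (_∣_; divides; _∣?_; m%n≡0⇒n∣m)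
  open import Data.List using (List; []; _∷_; _++_; [_]; map; length; filter; replicate)
  open import Data.List.Relation.Unary.Any using (here; there)
  open import Data.List.Relation.Unary.All as All using (All; []; _∷_)
  import Data.List.Relation.Unary.All.Properties as AllP
  open import Data.List.Relation.Unary.AllPairs using ([]; _∷_)
  open import Data.List.Relation.Unary.Unique.Propositional using (Unique)
  import Data.List.Relation.Unary.Unique.Propositional.Properties as UP
  open import Data.List.Membership.Propositional using (_∈_; find)
  import Data.List.Membership.Propositional.Properties as MemP
  open import Data.List.Relation.Unary.All.Properties using (¬All⇒Any¬)
  import Data.List.Properties as LP
  open import Relation.Binary.PropositionalEquality as P using (_≡_; _≢_; refl; sym; trans; cong; cong₂; subst)
  open import Relation.Nullary using (yes; no; ¬_; does)
  open import Relation.Nullary using (¬?)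
  open import Data.Product using (_×_; _,_; Σ; proj₂)
  open import Data.Empty using (⊥-elim)
  open import Data.Bool using (if_then_else_)
  open FieldProperties 𝔽
  open import Algebra.Properties.Ring (CommutativeRing.ring fieldRing) using (-‿distribˡ-*; -‿involutive)
  module FS = RingListSum fieldRing
  module FP = ListSum (CommutativeRing.*-commutativeMonoid fieldRing)
  open FieldSolver using (solve; _:=_; _:*_; _:+_)
  open P.≡-Reasoning

  sumF : {A : Set} → List A → (A → Carrier) → Carrier
  sumF = FS.sumL
  prodF : {A : Set} → List A → (A → Carrier) → Carrier
  prodF = FP.sumL

  powF-+ : ∀ x m n → powF x (m +ℕ n) ≡ powF x m ⊗ powF x n
  powF-+ x zero n = sym (⊗-idˡ _)
  powF-+ x (suc m) n = trans (cong (x ⊗_) (powF-+ x m n)) (sym (⊗-assoc _ _ _))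

  powF-mul : ∀ x y n → powF (x ⊗ y) n ≡ powF x n ⊗ powF y n
  powF-mul x y zero = sym (⊗-idˡ 𝟙)
  powF-mul x y (suc n) = trans (cong ((x ⊗ y) ⊗_) (powF-mul x y n))
    (solve 4 (λ a b c d → (a :* b) :* (c :* d) := (a :* c) :* (b :* d)) refl x y _ _)

  powF-one : ∀ n → powF 𝟙 n ≡ 𝟙
  powF-one zero = refl
  powF-one (suc n) = trans (⊗-idˡ _) (powF-one n)

  powF-multiple : ∀ x n k → powF x n ≡ 𝟙 → powF x (k *ℕ n) ≡ 𝟙
  powF-multiple x n zero e = refl
  powF-multiple x n (suc k) e = trans (powF-+ x n (k *ℕ n)) (trans (cong₂ _⊗_ e (powF-multiple x n k e)) (⊗-idˡ 𝟙))

  x⊖y≡𝟘⇒x≡y : ∀ {x y} → x ⊕ ⊖ y ≡ 𝟘 → x ≡ y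
  x⊖y≡𝟘⇒x≡y {x} {y} e = sym (trans (sym (-‿involutive y)) (trans (cong ⊖_ (⊖-unique e)) (-‿involutive x)))

  nonzeros : List Carrier
  nonzeros = filter (λ x → ¬? (x ≟ 𝟘)) elements

  nonzeros-unique : Unique nonzeros
  nonzeros-unique = UP.filter⁺ _ elements-unique

  ∈nonzeros : ∀ {x} → x ≢ 𝟘 → x ∈ nonzeros
  ∈nonzeros {x} x0 = MemP.∈-filter⁺ (λ x → ¬? (x ≟ 𝟘)) (elements-complete x) x0

  nonzeros-nonzero : ∀ {x} → x ∈ nonzeros → x ≢ 𝟘
  nonzeros-nonzero p = proj₂ (MemP.∈-filter⁻ (λ x → ¬? (x ≟ 𝟘)) {xs = elements} p)

  private
    len-filter : ∀ xs → Unique xs → 𝟘 ∈ xs → suc (length (filter (λ x → ¬? (x ≟ 𝟘)) xs)) ≡ length xs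
    len-filter (a ∷ xs) (ax ∷ u) (here 0≡a) with a ≟ 𝟘
    ... | no a≢0 = ⊥-elim (a≢0 (sym 0≡a))
    ... | yes a≡0 = cong suc (cong length (LP.filter-all (λ x → ¬? (x ≟ 𝟘)) (All.map (λ {y} a≢y y≡0 → a≢y (trans a≡0 (sym y≡0))) ax)))
    len-filter (a ∷ xs) (ax ∷ u) (there p) with a ≟ 𝟘
    ... | yes a≡0 = ⊥-elim (All.lookup ax p a≡0)
    ... | no _ = cong suc (len-filter xs u p)

  length-nonzeros : suc (length nonzeros) ≡ card
  length-nonzeros = len-filter elements elements-unique (elements-complete 𝟘)

  sum-𝟙 : ∀ (xs : List Carrier) → sumF xs (λ _ → 𝟙) ≡ natF (length xs)
  sum-𝟙 [] = refl
  sum-𝟙 (x ∷ xs) = cong (𝟙 ⊕_) (sum-𝟙 xs)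

  -- Translation by 𝟙 permutes 𝔽, so Σ x = Σ (x ⊕ 𝟙) = Σ x ⊕ q.
  natF-card≡𝟘 : natF card ≡ 𝟘
  natF-card≡𝟘 = ⊕-cancelˡ {Σx} (trans (⊕-comm Σx _) (trans (sym e) (sym (⊕-idʳ Σx))))
    where
    Σx : Carrier
    Σx = sumF elements (λ x → x)
    e : Σx ≡ natF card ⊕ Σx
    e = begin
      Σx ≡⟨ sym (FS.sum-bij elements elements-unique elements-complete (_⊕ 𝟙) (_⊕ ⊖ 𝟙)
                ⊕𝟙⊖𝟙 ⊖𝟙⊕𝟙 (λ x → x)) ⟩
      sumF elements (λ x → x ⊕ 𝟙) ≡⟨ FS.sum-∙ elements (λ x → x) (λ _ → 𝟙) ⟩
      Σx ⊕ sumF elements (λ _ → 𝟙) ≡⟨ cong (Σx ⊕_) (sum-𝟙 elements) ⟩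
      Σx ⊕ natF card ≡⟨ ⊕-comm _ _ ⟩
      natF card ⊕ Σx ∎
      where
      ⊕𝟙⊖𝟙 : ∀ x → (x ⊕ 𝟙) ⊕ ⊖ 𝟙 ≡ x
      ⊕𝟙⊖𝟙 x = trans (⊕-assoc _ _ _) (trans (cong (x ⊕_) (⊖-invʳ 𝟙)) (⊕-idʳ x))
      ⊖𝟙⊕𝟙 : ∀ x → (x ⊕ ⊖ 𝟙) ⊕ 𝟙 ≡ x
      ⊖𝟙⊕𝟙 x = trans (⊕-assoc _ _ _) (trans (cong (x ⊕_) (⊖-invˡ 𝟙)) (⊕-idʳ x))

  prod-nonzero : ∀ xs → All (_≢ 𝟘) xs → prodF xs (λ x → x) ≢ 𝟘
  prod-nonzero [] [] = 𝟙≢𝟘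
  prod-nonzero (x ∷ xs) (p ∷ ps) = ⊗-nonzero p (prod-nonzero xs ps)

  prod-scale : ∀ c xs → prodF xs (λ x → c ⊗ x) ≡ powF c (length xs) ⊗ prodF xs (λ x → x)
  prod-scale c [] = sym (⊗-idˡ 𝟙)
  prod-scale c (x ∷ xs) = trans (cong ((c ⊗ x) ⊗_) (prod-scale c xs))
    (solve 4 (λ c x a b → (c :* x) :* (a :* b) := (c :* a) :* (x :* b)) refl c x _ _)

  ⊗-cancelʳ : ∀ {a b c} → c ≢ 𝟘 → a ⊗ c ≡ b ⊗ c → a ≡ b
  ⊗-cancelʳ {a} {b} {c} c0 e = x⊖y≡𝟘⇒x≡y (x⊗y≡𝟘⇒y≡𝟘 c0 (begin
    c ⊗ (a ⊕ ⊖ b) ≡⟨ ⊗-comm c _ ⟩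
    (a ⊕ ⊖ b) ⊗ c ≡⟨ ⊗-distribʳ c a (⊖ b) ⟩
    a ⊗ c ⊕ (⊖ b) ⊗ c ≡⟨ cong₂ _⊕_ e (sym (-‿distribˡ-* b c)) ⟩
    b ⊗ c ⊕ ⊖ (b ⊗ c) ≡⟨ ⊖-invʳ _ ⟩
    𝟘 ∎))

  -- Multiplication by c permutes the nonzero elements, so their product Π satisfies c ^ (q - 1) Π = Π.
  fermat : ∀ {c} → c ≢ 𝟘 → powF c (length nonzeros) ≡ 𝟙
  fermat {c} c0 = ⊗-cancelʳ Π≢𝟘 (begin
    powF c (length nonzeros) ⊗ Π ≡⟨ sym (prod-scale c nonzeros) ⟩
    prodF nonzeros (λ x → c ⊗ x) ≡⟨ sym (FP.sum-map (c ⊗_) nonzeros (λ x → x)) ⟩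
    prodF (map (c ⊗_) nonzeros) (λ x → x) ≡⟨ FP.sum-unique-sameMembers (map (c ⊗_) nonzeros) nonzeros (λ x → x) c⊗-unique nonzeros-unique c⊗-closed c⊗-onto ⟩
    Π ≡⟨ sym (⊗-idˡ Π) ⟩
    𝟙 ⊗ Π ∎)
    where
    Π : Carrier
    Π = prodF nonzeros (λ x → x)
    Π≢𝟘 : Π ≢ 𝟘
    Π≢𝟘 = prod-nonzero nonzeros (All.tabulate nonzeros-nonzero)
    c⊗-injective : ∀ {x y} → c ⊗ x ≡ c ⊗ y → x ≡ y
    c⊗-injective {x} {y} e = ⊗-cancelʳ c0 (trans (⊗-comm x c) (trans e (⊗-comm c y)))
    c⊗-unique : Unique (map (c ⊗_) nonzeros)
    c⊗-unique = UP.map⁺ c⊗-injective nonzeros-unique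
    c⊗-closed : ∀ {z} → z ∈ map (c ⊗_) nonzeros → z ∈ nonzeros
    c⊗-closed z∈ with MemP.∈-map⁻ (c ⊗_) z∈
    ... | x , x∈ , refl = ∈nonzeros (⊗-nonzero c0 (nonzeros-nonzero x∈))
    c⊗-onto : ∀ {z} → z ∈ nonzeros → z ∈ map (c ⊗_) nonzeros
    c⊗-onto {z} z∈ = subst (_∈ map (c ⊗_) nonzeros) e (MemP.∈-map⁺ (c ⊗_) (∈nonzeros (⊗-nonzero (inv-nonzero c0) (nonzeros-nonzero z∈))))
      where
      e : c ⊗ (inv c ⊗ z) ≡ z
      e = trans (sym (⊗-assoc _ _ _)) (trans (cong (_⊗ z) (inv-correct c c0)) (⊗-idˡ z))

  eval : List Carrier → Carrier → Carrier
  eval [] x = 𝟘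
  eval (a ∷ p) x = a ⊕ x ⊗ eval p x

  syntheticDiv : Carrier → List Carrier → List Carrier
  syntheticDiv c [] = []
  syntheticDiv c (a ∷ []) = []
  syntheticDiv c (a ∷ b ∷ p) = eval (b ∷ p) c ∷ syntheticDiv c (b ∷ p)

  eval-div : ∀ c p x → eval p x ≡ (x ⊕ ⊖ c) ⊗ eval (syntheticDiv c p) x ⊕ eval p c
  eval-div c [] x = sym (trans (⊕-idʳ _) (⊗-zeroʳ _))
  eval-div c (a ∷ []) x = begin
    a ⊕ x ⊗ 𝟘 ≡⟨ cong (a ⊕_) (⊗-zeroʳ x) ⟩
    a ⊕ 𝟘 ≡⟨ sym (cong (a ⊕_) (⊗-zeroʳ c)) ⟩
    a ⊕ c ⊗ 𝟘 ≡⟨ sym (⊕-idˡ _) ⟩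
    𝟘 ⊕ (a ⊕ c ⊗ 𝟘) ≡⟨ cong (_⊕ (a ⊕ c ⊗ 𝟘)) (sym (⊗-zeroʳ _)) ⟩
    (x ⊕ ⊖ c) ⊗ 𝟘 ⊕ (a ⊕ c ⊗ 𝟘) ∎
  eval-div c (a ∷ b ∷ p) x = begin
    a ⊕ x ⊗ eval (b ∷ p) x ≡⟨ cong (λ u → a ⊕ x ⊗ u) (eval-div c (b ∷ p) x) ⟩
    a ⊕ x ⊗ ((x ⊕ nc) ⊗ Dv ⊕ Ec)
      ≡⟨ sym (trans (cong (a ⊕ x ⊗ ((x ⊕ nc) ⊗ Dv ⊕ Ec) ⊕_) (trans (cong (_⊗ Ec) (⊖-invˡ c)) (⊗-zeroˡ Ec))) (⊕-idʳ _)) ⟩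
    (a ⊕ x ⊗ ((x ⊕ nc) ⊗ Dv ⊕ Ec)) ⊕ (nc ⊕ c) ⊗ Ec
      ≡⟨ solve 6 (λ a x nc Dv Ec c → a :+ x :* ((x :+ nc) :* Dv :+ Ec) :+ (nc :+ c) :* Ec := (x :+ nc) :* (Ec :+ x :* Dv) :+ (a :+ c :* Ec)) refl a x nc Dv Ec c ⟩
    (x ⊕ nc) ⊗ (Ec ⊕ x ⊗ Dv) ⊕ (a ⊕ c ⊗ Ec) ∎
    where
    q : List Carrier
    q = b ∷ p
    nc Dv Ec : Carrier
    nc = ⊖ c
    Dv = eval (syntheticDiv c q) x
    Ec = eval q c

  div-zero : ∀ c p → eval p c ≡ 𝟘 → All (_≡ 𝟘) (syntheticDiv c p) → All (_≡ 𝟘) p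
  div-zero c [] e _ = []
  div-zero c (a ∷ []) e _ = trans (sym (trans (cong (a ⊕_) (⊗-zeroʳ c)) (⊕-idʳ a))) e ∷ []
  div-zero c (a ∷ b ∷ p) e (E0 ∷ rest) = a0 ∷ div-zero c (b ∷ p) E0 rest
    where
    a0 : a ≡ 𝟘
    a0 = trans (sym (trans (cong (λ u → a ⊕ c ⊗ u) E0) (trans (cong (a ⊕_) (⊗-zeroʳ c)) (⊕-idʳ a)))) e

  len-div : ∀ c p → length (syntheticDiv c p) ≡ length p ∸ 1
  len-div c [] = refl
  len-div c (a ∷ []) = refl
  len-div c (a ∷ b ∷ p) = cong suc (len-div c (b ∷ p))

  root-bound : ∀ cs → Unique cs → ∀ p → length p ≤ length cs → All (λ c → eval p c ≡ 𝟘) cs → All (_≡ 𝟘) p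
  root-bound [] u [] le rs = []
  root-bound [] u (a ∷ p) () rs
  root-bound (c ∷ cs) (ac ∷ u) p le (rc ∷ rs) = div-zero c p rc (root-bound cs u (syntheticDiv c p) le' rs')
    where
    le' : length (syntheticDiv c p) ≤ length cs
    le' = subst (_≤ length cs) (sym (len-div c p)) (ℕP.∸-monoˡ-≤ {length p} {suc (length cs)} 1 le)
    rs' : All (λ c' → eval (syntheticDiv c p) c' ≡ 𝟘) cs
    rs' = All.tabulate λ {c'} c'∈ → x⊗y≡𝟘⇒y≡𝟘 (λ e → All.lookup ac c'∈ (sym (x⊖y≡𝟘⇒x≡y e)))
      (begin
        (c' ⊕ ⊖ c) ⊗ eval (syntheticDiv c p) c' ≡⟨ sym (⊕-idʳ _) ⟩
        (c' ⊕ ⊖ c) ⊗ eval (syntheticDiv c p) c' ⊕ 𝟘 ≡⟨ cong ((c' ⊕ ⊖ c) ⊗ eval (syntheticDiv c p) c' ⊕_) (sym rc) ⟩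
        (c' ⊕ ⊖ c) ⊗ eval (syntheticDiv c p) c' ⊕ eval p c ≡⟨ sym (eval-div c p c') ⟩
        eval p c' ≡⟨ All.lookup rs c'∈ ⟩
        𝟘 ∎)

  eval-monomial : ∀ r x → eval (replicate r 𝟘 ++ [ 𝟙 ]) x ≡ powF x r
  eval-monomial zero x = trans (cong (𝟙 ⊕_) (⊗-zeroʳ x)) (⊕-idʳ 𝟙)
  eval-monomial (suc r) x = trans (⊕-idˡ _) (cong (x ⊗_) (eval-monomial r x))

  -- Otherwise X ^ (r + 1) - 1 would vanish at all q - 1 > r + 1 nonzero elements, more roots than its degree.
  ∃-nonroot : ∀ r → suc r < length nonzeros → Σ Carrier (λ μ → μ ≢ 𝟘 × powF μ (suc r) ≢ 𝟙)
  ∃-nonroot r lt with All.all? (λ μ → powF μ (suc r) ≟ 𝟙) nonzeros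
  ... | no ¬all with find (¬All⇒Any¬ (λ μ → powF μ (suc r) ≟ 𝟙) nonzeros ¬all)
  ...   | μ , μ∈ , nμ = μ , nonzeros-nonzero μ∈ , nμ
  ∃-nonroot r lt | yes all1 = ⊥-elim (𝟘≢𝟙 (sym last1))
    where
    pr : List Carrier
    pr = ⊖ 𝟙 ∷ (replicate r 𝟘 ++ [ 𝟙 ])
    lenpr : length pr ≤ length nonzeros
    lenpr = subst (_≤ length nonzeros) (cong suc (sym (trans (LP.length-++ (replicate r 𝟘)) (trans (cong (_+ℕ 1) (LP.length-replicate r)) (ℕP.+-comm r 1))))) lt
    roots : All (λ c → eval pr c ≡ 𝟘) nonzeros
    roots = All.map (λ {μ} e → trans (cong (⊖ 𝟙 ⊕_) (trans (cong (μ ⊗_) (eval-monomial r μ)) e)) (⊖-invˡ 𝟙)) all1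
    z : All (_≡ 𝟘) pr
    z = root-bound nonzeros nonzeros-unique pr lenpr roots
    last1 : 𝟙 ≡ 𝟘
    last1 with z
    ... | _ ∷ zs with AllP.++⁻ʳ (replicate r 𝟘) zs
    ...   | e ∷ [] = e

  q∸1≡length-nonzeros : card ∸ 1 ≡ length nonzeros
  q∸1≡length-nonzeros = cong (_∸ 1) (sym length-nonzeros)

  ∃-nonroot-of-unity : ∀ j → ¬ (card ∸ 1 ∣ j) → Σ Carrier (λ μ → μ ≢ 𝟘 × powF μ j ≢ 𝟙)
  ∃-nonroot-of-unity j nd with length nonzeros in eqn
  ... | zero = ⊥-elim (mem-len (∈nonzeros 𝟙≢𝟘) eqn)
    where
    mem-len : ∀ {x : Carrier} {xs} → x ∈ xs → length xs ≢ 0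
    mem-len (here _) ()
    mem-len (there _) ()
  ... | suc n' with j % suc n' in eqr
  ...   | zero = ⊥-elim (nd (subst (_∣ j) (sym (trans q∸1≡length-nonzeros eqn)) (m%n≡0⇒n∣m j (suc n') eqr)))
  ...   | suc r' with ∃-nonroot r' (subst (suc r' ℕ.<_) (sym eqn) (subst (ℕ._< suc n') eqr (m%n<n j (suc n'))))
  ...     | μ , μ0 , nμ = μ , μ0 , λ e → nμ (begin
            powF μ (suc r') ≡⟨ sym (⊗-idʳ _) ⟩
            powF μ (suc r') ⊗ 𝟙 ≡⟨ cong (powF μ (suc r') ⊗_) (sym (powF-multiple μ (suc n') (j / suc n') (trans (cong (powF μ) (sym eqn)) (fermat μ0)))) ⟩
            powF μ (suc r') ⊗ powF μ ((j / suc n') *ℕ suc n') ≡⟨ sym (powF-+ μ (suc r') _) ⟩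
            powF μ (suc r' +ℕ (j / suc n') *ℕ suc n') ≡⟨ cong (λ u → powF μ (u +ℕ (j / suc n') *ℕ suc n')) (sym eqr) ⟩
            powF μ (j % suc n' +ℕ (j / suc n') *ℕ suc n') ≡⟨ cong (powF μ) (sym (m≡m%n+[m/n]*n j (suc n'))) ⟩
            powF μ j ≡⟨ e ⟩
            𝟙 ∎)

  fermat-∣ : ∀ {c j} → c ≢ 𝟘 → card ∸ 1 ∣ j → powF c j ≡ 𝟙
  fermat-∣ {c} c≢𝟘 (divides k refl) =
    powF-multiple c (card ∸ 1) k (trans (cong (powF c) q∸1≡length-nonzeros) (fermat c≢𝟘))

  invPowTerm : ℕ → Carrier → Carrier
  invPowTerm j c = if does (c ≟ 𝟘) then 𝟘 else powF (inv c) j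

  invPowSum : ℕ → Carrier
  invPowSum j = sumF elements (invPowTerm j)

  module Ind = FS.Indicator _≟_

  invPowSum-∣ : ∀ j → card ∸ 1 ∣ j → invPowSum j ≡ ⊖ 𝟙
  invPowSum-∣ j q-1∣j = ⊖-unique (begin
    𝟙 ⊕ invPowSum j ≡⟨ cong (_⊕ invPowSum j) (sym (Ind.sum-indicator-∈ elements elements-unique 𝟘 (λ _ → 𝟙) (elements-complete 𝟘))) ⟩
    sumF elements (λ c → if does (c ≟ 𝟘) then 𝟙 else 𝟘) ⊕ invPowSum j ≡⟨ sym (FS.sum-∙ elements _ _) ⟩
    sumF elements (λ c → (if does (c ≟ 𝟘) then 𝟙 else 𝟘) ⊕ invPowTerm j c) ≡⟨ FS.sum-cong' elements termwise ⟩
    sumF elements (λ _ → 𝟙) ≡⟨ sum-𝟙 elements ⟩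
    natF card ≡⟨ natF-card≡𝟘 ⟩
    𝟘 ∎)
    where
    termwise : ∀ c → (if does (c ≟ 𝟘) then 𝟙 else 𝟘) ⊕ invPowTerm j c ≡ 𝟙
    termwise c with c ≟ 𝟘
    ... | yes _ = ⊕-idʳ 𝟙
    ... | no c0 = trans (⊕-idˡ _) (fermat-∣ (inv-nonzero c0) q-1∣j)

  -- Multiplication by μ permutes 𝔽, so invPowSum j = μ ^ (- j) ⊗ invPowSum j with μ ^ (- j) ≢ 𝟙.
  invPowSum-∤ : ∀ j → ¬ (card ∸ 1 ∣ j) → invPowSum j ≡ 𝟘
  invPowSum-∤ j nd with ∃-nonroot-of-unity j nd
  ... | μ , μ0 , nμ with invPowSum j ≟ 𝟘
  ...   | yes e = e
  ...   | no σ0 = ⊥-elim (ν≢1 (⊗-cancelʳ σ0 (trans (sym eσ) (sym (⊗-idˡ _)))))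
    where
    ν : Carrier
    ν = powF (inv μ) j
    μμ : μ ⊗ inv μ ≡ 𝟙
    μμ = inv-correct μ μ0
    ν≢1 : ν ≢ 𝟙
    ν≢1 e = nμ (begin
      powF μ j ≡⟨ sym (⊗-idʳ _) ⟩
      powF μ j ⊗ 𝟙 ≡⟨ cong (powF μ j ⊗_) (sym e) ⟩
      powF μ j ⊗ ν ≡⟨ sym (powF-mul μ (inv μ) j) ⟩
      powF (μ ⊗ inv μ) j ≡⟨ cong (λ u → powF u j) μμ ⟩
      powF 𝟙 j ≡⟨ powF-one j ⟩
      𝟙 ∎)
    termwise : ∀ c → invPowTerm j (μ ⊗ c) ≡ ν ⊗ invPowTerm j c
    termwise c with c ≟ 𝟘 | (μ ⊗ c) ≟ 𝟘
    ... | yes _ | yes _ = sym (⊗-zeroʳ ν)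
    ... | yes c0 | no μc0 = ⊥-elim (μc0 (trans (cong (μ ⊗_) c0) (⊗-zeroʳ μ)))
    ... | no c0 | yes μc0 = ⊥-elim (⊗-nonzero μ0 c0 μc0)
    ... | no c0 | no μc0 = trans (cong (λ u → powF u j) (inv-⊗ μ0 c0)) (powF-mul (inv μ) (inv c) j)
    eσ : invPowSum j ≡ ν ⊗ invPowSum j
    eσ = begin
      invPowSum j ≡⟨ sym (FS.sum-bij elements elements-unique elements-complete (μ ⊗_) (inv μ ⊗_) ττ σσ (invPowTerm j)) ⟩
      sumF elements (λ c → invPowTerm j (μ ⊗ c)) ≡⟨ FS.sum-cong' elements termwise ⟩
      sumF elements (λ c → ν ⊗ invPowTerm j c) ≡⟨ sym (FS.sum-*ˡ ν elements (invPowTerm j)) ⟩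
      ν ⊗ invPowSum j ∎
      where
      ττ : ∀ x → inv μ ⊗ (μ ⊗ x) ≡ x
      ττ x = trans (sym (⊗-assoc _ _ _)) (trans (cong (_⊗ x) (trans (⊗-comm _ _) μμ)) (⊗-idˡ x))
      σσ : ∀ x → μ ⊗ (inv μ ⊗ x) ≡ x
      σσ x = trans (sym (⊗-assoc _ _ _)) (trans (cong (_⊗ x) μμ) (⊗-idˡ x))

  invPowSum≡ : ∀ j → invPowSum j ≡ (if does (card ∸ 1 ∣? j) then ⊖ 𝟙 else 𝟘)
  invPowSum≡ j with card ∸ 1 ∣? j
  ... | yes d = invPowSum-∣ j d
  ... | no nd = invPowSum-∤ j nd


module SignedBinomial (𝔽 : FiniteField) where

  import Defs as D
  open import Data.Nat using (ℕ; zero; suc; _+_; _<_; _∸_)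
  import Data.Nat.Properties as ℕP
  open import Data.Nat.Combinatorics using (_C_; k>n⇒nCk≡0; nCk+nC[k+1]≡[n+1]C[k+1])
  open import Relation.Binary.PropositionalEquality as P using (_≡_; refl; sym; trans; cong; cong₂)
  open import Data.Nat.Divisibility using (_∣_)
  open FieldProperties 𝔽
  open PowerSums 𝔽 using (fermat-∣; powF-+)
  import Algebra.Properties.Ring as RPr
  open RPr (CommutativeRing.ring fieldRing) using (-‿distribˡ-*; -‿involutive; -‿+-comm; -1*x≈-x)
  open FieldSolver using (solve; _:=_; _:*_; _:+_)
  open P.≡-Reasoning

  sign : ℕ → Carrier
  sign n = powF (⊖ 𝟙) n

  sign-suc : ∀ n → sign (suc n) ≡ ⊖ sign n
  sign-suc n = -1*x≈-x (sign n)

  sign-suc-suc : ∀ n → sign (suc (suc n)) ≡ sign n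
  sign-suc-suc n = trans (sign-suc (suc n)) (trans (cong ⊖_ (sign-suc n)) (-‿involutive (sign n)))

  sign-∣ : ∀ {j} → card ∸ 1 ∣ j → sign j ≡ 𝟙
  sign-∣ = fermat-∣ ⊖𝟙≢𝟘

  natF-+ : ∀ m n → natF (m + n) ≡ natF m ⊕ natF n
  natF-+ zero n = sym (⊕-idˡ _)
  natF-+ (suc m) n = trans (cong (𝟙 ⊕_) (natF-+ m n)) (sym (⊕-assoc _ _ _))

  shiftedBinom : ℕ → ℕ → ℕ
  shiftedBinom zero zero = 1
  shiftedBinom zero (suc j) = 0
  shiftedBinom (suc s) zero = 0
  shiftedBinom (suc s) (suc j) = j C s

  shiftedBinom-pascal : ∀ s j → shiftedBinom (suc s) (suc j) ≡ shiftedBinom s j + shiftedBinom (suc s) j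
  shiftedBinom-pascal zero zero = refl
  shiftedBinom-pascal zero (suc j) = refl
  shiftedBinom-pascal (suc s) zero = refl
  shiftedBinom-pascal (suc s) (suc j) = sym (nCk+nC[k+1]≡[n+1]C[k+1] j s)

  shiftedBinom-< : ∀ k a → a < k → shiftedBinom (suc k) (suc a) ≡ 0
  shiftedBinom-< k a a<k = k>n⇒nCk≡0 a<k

  pfCoeff : ℕ → ℕ → ℕ → Carrier
  pfCoeff r s j = sign (j + s) ⊗ natF (shiftedBinom s j) ⊕ sign r ⊗ natF (shiftedBinom r j)

  pfCoeff-0 : ∀ r s → pfCoeff (suc r) (suc s) 0 ≡ 𝟘
  pfCoeff-0 r s = trans (cong₂ _⊕_ (⊗-zeroʳ _) (⊗-zeroʳ _)) (⊕-idˡ 𝟘)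

  natF-1 : natF 1 ≡ 𝟙
  natF-1 = ⊕-idʳ 𝟙

  pfCoeff-r0-0 : ∀ r → pfCoeff (suc r) 0 0 ≡ 𝟙
  pfCoeff-r0-0 r = trans (cong₂ _⊕_ (trans (⊗-idˡ _) natF-1) (⊗-zeroʳ _)) (⊕-idʳ 𝟙)

  pfCoeff-r0-suc : ∀ r a → a < r → pfCoeff (suc r) 0 (suc a) ≡ 𝟘
  pfCoeff-r0-suc r a a<r = trans (cong₂ _⊕_ (⊗-zeroʳ _) (trans (cong (λ n → sign (suc r) ⊗ natF n) (shiftedBinom-< r a a<r)) (⊗-zeroʳ _))) (⊕-idˡ 𝟘)

  pfCoeff-0s-0 : ∀ s → pfCoeff 0 (suc s) 0 ≡ 𝟙
  pfCoeff-0s-0 s = trans (cong₂ _⊕_ (⊗-zeroʳ _) (trans (⊗-idˡ _) natF-1)) (⊕-idˡ 𝟙)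

  pfCoeff-0s-suc : ∀ s a → a < s → pfCoeff 0 (suc s) (suc a) ≡ 𝟘
  pfCoeff-0s-suc s a a<s = trans (cong₂ _⊕_ (trans (cong (λ n → sign (suc a + suc s) ⊗ natF n) (shiftedBinom-< s a a<s)) (⊗-zeroʳ _)) (⊗-zeroʳ _)) (⊕-idˡ 𝟘)

  pfCoeff-pascal : ∀ r s j → pfCoeff (suc r) (suc s) (suc j) ≡ pfCoeff (suc r) s j ⊕ ⊖ pfCoeff r (suc s) j
  pfCoeff-pascal r s j = begin
    sign (suc j + suc s) ⊗ natF (shiftedBinom (suc s) (suc j)) ⊕ sign (suc r) ⊗ natF (shiftedBinom (suc r) (suc j))
      ≡⟨ cong₂ _⊕_ (cong₂ _⊗_ e1 (trans (cong natF (shiftedBinom-pascal s j)) (natF-+ (shiftedBinom s j) _)))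
                   (cong₂ _⊗_ (sign-suc r) (trans (cong natF (shiftedBinom-pascal r j)) (natF-+ (shiftedBinom r j) _))) ⟩
    X ⊗ (a ⊕ b) ⊕ (⊖ Y) ⊗ (e ⊕ c)
      ≡⟨ solve 7 (λ X nY a b c e nX → X :* (a :+ b) :+ nY :* (e :+ c) := X :* a :+ nY :* c :+ (X :* b :+ nY :* e)) refl X (⊖ Y) a b c e (⊖ X) ⟩
    (X ⊗ a ⊕ (⊖ Y) ⊗ c) ⊕ (X ⊗ b ⊕ (⊖ Y) ⊗ e)
      ≡⟨ cong ((X ⊗ a ⊕ (⊖ Y) ⊗ c) ⊕_) neg ⟩
    (X ⊗ a ⊕ (⊖ Y) ⊗ c) ⊕ ⊖ ((⊖ X) ⊗ b ⊕ Y ⊗ e)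
      ≡⟨ cong₂ (λ u v → (X ⊗ a ⊕ u ⊗ c) ⊕ ⊖ (v ⊗ b ⊕ Y ⊗ e)) (sym (sign-suc r)) (sym e2) ⟩
    pfCoeff (suc r) s j ⊕ ⊖ pfCoeff r (suc s) j ∎
    where
    X Y a b c e : Carrier
    X = sign (j + s)
    Y = sign r
    a = natF (shiftedBinom s j)
    b = natF (shiftedBinom (suc s) j)
    c = natF (shiftedBinom (suc r) j)
    e = natF (shiftedBinom r j)
    e1 : sign (suc j + suc s) ≡ X
    e1 = trans (cong (λ n → sign (suc n)) (ℕP.+-suc j s)) (sign-suc-suc (j + s))
    e2 : sign (j + suc s) ≡ ⊖ X
    e2 = trans (cong sign (ℕP.+-suc j s)) (sign-suc (j + s))
    neg : X ⊗ b ⊕ (⊖ Y) ⊗ e ≡ ⊖ ((⊖ X) ⊗ b ⊕ Y ⊗ e)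
    neg = sym (trans (sym (-‿+-comm _ _)) (cong₂ _⊕_ (trans (cong ⊖_ (sym (-‿distribˡ-* X b))) (-‿involutive _)) (-‿distribˡ-* Y e)))

  pfCoeff≡Δ : ∀ r s a → card ∸ 1 ∣ suc a → pfCoeff (suc r) (suc s) (suc a) ⊗ ⊖ 𝟙 ≡ D.Δ 𝔽 (suc r) (suc s) (suc a)
  pfCoeff≡Δ r s a dv = begin
    (X ⊗ cs ⊕ sign (suc r) ⊗ cr) ⊗ ⊖ 𝟙 ≡⟨ ⊗-comm _ (⊖ 𝟙) ⟩
    ⊖ 𝟙 ⊗ (X ⊗ cs ⊕ sign (suc r) ⊗ cr) ≡⟨ -1*x≈-x _ ⟩
    ⊖ (X ⊗ cs ⊕ sign (suc r) ⊗ cr) ≡⟨ sym (-‿+-comm _ _) ⟩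
    ⊖ (X ⊗ cs) ⊕ ⊖ (sign (suc r) ⊗ cr) ≡⟨ cong₂ _⊕_ (trans (-‿distribˡ-* X cs) (cong (_⊗ cs) negX)) (trans (-‿distribˡ-* (sign (suc r)) cr) (cong (_⊗ cr) (trans (cong ⊖_ (sign-suc r)) (-‿involutive (sign r))))) ⟩
    sign s ⊗ cs ⊕ sign r ⊗ cr ≡⟨ ⊕-comm _ _ ⟩
    sign r ⊗ cr ⊕ sign s ⊗ cs ∎
    where
    X cs cr : Carrier
    X = sign (suc a + suc s)
    cs = natF (a C s)
    cr = natF (a C r)
    negX : ⊖ X ≡ sign s
    negX = begin
      ⊖ sign (suc a + suc s) ≡⟨ cong ⊖_ (powF-+ (⊖ 𝟙) (suc a) (suc s)) ⟩
      ⊖ (sign (suc a) ⊗ sign (suc s)) ≡⟨ cong (λ u → ⊖ (u ⊗ sign (suc s))) (sign-∣ dv) ⟩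
      ⊖ (𝟙 ⊗ sign (suc s)) ≡⟨ cong ⊖_ (⊗-idˡ _) ⟩
      ⊖ sign (suc s) ≡⟨ cong ⊖_ (sign-suc s) ⟩
      ⊖ ⊖ sign s ≡⟨ -‿involutive (sign s) ⟩
      sign s ∎


module PartialFractionExpansion (𝔽 : FiniteField) (R : CommutativeRing 0ℓ 0ℓ) where

  open import Data.Nat using (ℕ; zero; suc; _<_; s≤s) renaming (_+_ to _+ℕ_)
  import Data.Nat.Properties as ℕP
  open import Data.List using (List; []; _∷_; _++_; [_])
  open import Data.List.Membership.Propositional using (_∈_)
  open import Relation.Binary.PropositionalEquality as P using (_≡_)
  open import Defs using (range1)
  open FieldProperties 𝔽 renaming (Carrier to FC) using (_⊕_; ⊖_; 𝟘; 𝟙)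
  open SignedBinomial 𝔽
  open CommutativeRing R
  open RingListSum R
  open import Algebra.Properties.CommutativeSemigroup +-commutativeSemigroup using (interchange)
  open import Relation.Binary.Reasoning.Setoid setoid
  open Solver using (solve; _:=_; _:*_; _:+_; con)

  private
    a+b≡r⇒a<1+r : ∀ {a b r} → a +ℕ b ≡ r → a < suc r
    a+b≡r⇒a<1+r {a} e = s≤s (ℕP.m+n≤o⇒m≤o a (ℕP.≤-reflexive e))

  antidiag : ℕ → (ℕ → ℕ → Carrier) → Carrier
  antidiag zero f = f 0 0
  antidiag (suc N) f = f 0 (suc N) + antidiag N (λ a b → f (suc a) b)

  antidiag-cong : ∀ N {f g : ℕ → ℕ → Carrier} → (∀ a b → a +ℕ b ≡ N → f a b ≈ g a b) → antidiag N f ≈ antidiag N g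
  antidiag-cong zero h = h 0 0 P.refl
  antidiag-cong (suc N) h = +-cong (h 0 (suc N) P.refl) (antidiag-cong N (λ a b e → h (suc a) b (P.cong suc e)))

  antidiag-+ : ∀ N (f g : ℕ → ℕ → Carrier) → antidiag N (λ a b → f a b + g a b) ≈ antidiag N f + antidiag N g
  antidiag-+ zero f g = refl
  antidiag-+ (suc N) f g = trans (+-congˡ (antidiag-+ N _ _)) (interchange _ _ _ _)

  antidiag-neg : ∀ N (f : ℕ → ℕ → Carrier) → antidiag N (λ a b → - f a b) ≈ - antidiag N f
  antidiag-neg zero f = refl
  antidiag-neg (suc N) f = trans (+-congˡ (antidiag-neg N _)) (-‿+-comm _ _)

  antidiag-zero : ∀ N (f : ℕ → ℕ → Carrier) → (∀ a b → a +ℕ b ≡ N → f a b ≈ 0#) → antidiag N f ≈ 0#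
  antidiag-zero zero f h = h 0 0 P.refl
  antidiag-zero (suc N) f h = trans (+-cong (h 0 (suc N) P.refl) (antidiag-zero N _ (λ a b e → h (suc a) b (P.cong suc e)))) (+-identityˡ 0#)

  antidiag-last : ∀ N (f : ℕ → ℕ → Carrier) → antidiag (suc N) f ≈ antidiag N (λ a b → f a (suc b)) + f (suc N) 0
  antidiag-last zero f = refl
  antidiag-last (suc N) f = trans (+-congˡ (antidiag-last N (λ a b → f (suc a) b))) (sym (+-assoc _ _ _))

  antidiag-*ˡ : ∀ N c (f : ℕ → ℕ → Carrier) → c * antidiag N f ≈ antidiag N (λ a b → c * f a b)
  antidiag-*ˡ zero c f = refl
  antidiag-*ˡ (suc N) c f = trans (distribˡ c (f 0 (suc N)) (antidiag N (λ a b → f (suc a) b))) (+-congˡ {c * f 0 (suc N)} (antidiag-*ˡ N c (λ a b → f (suc a) b)))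

  sum-range1 : ∀ N (h : ℕ → Carrier) → sumL (range1 𝔽 (suc N)) h ≈ antidiag N (λ a b → h (suc a))
  sum-range1 zero h = +-identityʳ (h 1)
  sum-range1 (suc N) h = begin
    sumL (range1 𝔽 (suc N) ++ [ suc (suc N) ]) h ≈⟨ sum-++ (range1 𝔽 (suc N)) [ suc (suc N) ] h ⟩
    sumL (range1 𝔽 (suc N)) h + (h (suc (suc N)) + 0#) ≈⟨ +-cong (sum-range1 N h) (+-identityʳ (h (suc (suc N)))) ⟩
    antidiag N (λ a b → h (suc a)) + h (suc (suc N)) ≈⟨ sym (antidiag-last N (λ a b → h (suc a))) ⟩
    antidiag (suc N) (λ a b → h (suc a)) ∎

  module Expansion (ι : FC → Carrier)
    (ι-+ : ∀ a b → ι (a ⊕ b) ≈ ι a + ι b)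
    (ι-⊖ : ∀ a → ι (⊖ a) ≈ - ι a)
    (ι-0 : ι 𝟘 ≈ 0#)
    (ι-1 : ι 𝟙 ≈ 1#)
    (A Z : ℕ → Carrier) where

    expansion : ℕ → ℕ → ℕ → ℕ → Carrier
    expansion N r s k = antidiag N (λ j m → ι (pfCoeff r s j) * (A (suc m) * Z (j +ℕ k)))

    expansion-pascal : ∀ N r s k → expansion (suc N) (suc r) (suc s) k ≈ expansion N (suc r) s (suc k) - expansion N r (suc s) (suc k)
    expansion-pascal N r s k = begin
      ι (pfCoeff (suc r) (suc s) 0) * (A (suc (suc N)) * Z k) + antidiag N (λ j m → ι (pfCoeff (suc r) (suc s) (suc j)) * (A (suc m) * Z (suc j +ℕ k)))
        ≈⟨ +-cong (trans (*-congʳ (trans (reflexive (P.cong ι (pfCoeff-0 r s))) ι-0)) (zeroˡ _)) (antidiag-cong N termwise) ⟩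
      0# + antidiag N (λ j m → ι (pfCoeff (suc r) s j) * (A (suc m) * Z (j +ℕ suc k)) + - (ι (pfCoeff r (suc s) j) * (A (suc m) * Z (j +ℕ suc k))))
        ≈⟨ +-identityˡ _ ⟩
      antidiag N (λ j m → ι (pfCoeff (suc r) s j) * (A (suc m) * Z (j +ℕ suc k)) + - (ι (pfCoeff r (suc s) j) * (A (suc m) * Z (j +ℕ suc k))))
        ≈⟨ antidiag-+ N _ _ ⟩
      expansion N (suc r) s (suc k) + antidiag N (λ j m → - (ι (pfCoeff r (suc s) j) * (A (suc m) * Z (j +ℕ suc k))))
        ≈⟨ +-congˡ (antidiag-neg N _) ⟩
      expansion N (suc r) s (suc k) - expansion N r (suc s) (suc k) ∎
      where
      termwise : ∀ j m → j +ℕ m ≡ N → ι (pfCoeff (suc r) (suc s) (suc j)) * (A (suc m) * Z (suc j +ℕ k))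
             ≈ ι (pfCoeff (suc r) s j) * (A (suc m) * Z (j +ℕ suc k)) + - (ι (pfCoeff r (suc s) j) * (A (suc m) * Z (j +ℕ suc k)))
      termwise j m _ = begin
        ι (pfCoeff (suc r) (suc s) (suc j)) * (A (suc m) * Z (suc j +ℕ k))
          ≈⟨ *-cong (trans (reflexive (P.cong ι (pfCoeff-pascal r s j))) (trans (ι-+ _ _) (+-congˡ (ι-⊖ _)))) (*-congˡ (reflexive (P.cong Z (P.sym (ℕP.+-suc j k))))) ⟩
        (ι (pfCoeff (suc r) s j) + - ι (pfCoeff r (suc s) j)) * (A (suc m) * Z (j +ℕ suc k))
          ≈⟨ distribʳ _ _ _ ⟩
        ι (pfCoeff (suc r) s j) * (A (suc m) * Z (j +ℕ suc k)) + - ι (pfCoeff r (suc s) j) * (A (suc m) * Z (j +ℕ suc k))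
          ≈⟨ +-congˡ (sym (-‿distribˡ-* _ _)) ⟩
        ι (pfCoeff (suc r) s j) * (A (suc m) * Z (j +ℕ suc k)) + - (ι (pfCoeff r (suc s) j) * (A (suc m) * Z (j +ℕ suc k))) ∎

    expansion-r0 : ∀ r k → expansion r (suc r) 0 k ≈ A (suc r) * Z k
    expansion-r0 zero k = trans (*-congʳ (trans (reflexive (P.cong ι (pfCoeff-r0-0 0))) ι-1)) (*-identityˡ _)
    expansion-r0 (suc r) k = begin
      ι (pfCoeff (suc (suc r)) 0 0) * (A (suc (suc r)) * Z k) + antidiag r (λ a b → ι (pfCoeff (suc (suc r)) 0 (suc a)) * (A (suc b) * Z (suc a +ℕ k)))
        ≈⟨ +-cong (trans (*-congʳ (trans (reflexive (P.cong ι (pfCoeff-r0-0 (suc r)))) ι-1)) (*-identityˡ _))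
                  (antidiag-zero r _ (λ a b e → trans (*-congʳ (trans (reflexive (P.cong ι (pfCoeff-r0-suc (suc r) a (a+b≡r⇒a<1+r e)))) ι-0)) (zeroˡ _))) ⟩
      A (suc (suc r)) * Z k + 0# ≈⟨ +-identityʳ _ ⟩
      A (suc (suc r)) * Z k ∎

    expansion-0s : ∀ s k → expansion s 0 (suc s) k ≈ A (suc s) * Z k
    expansion-0s zero k = trans (*-congʳ (trans (reflexive (P.cong ι (pfCoeff-0s-0 0))) ι-1)) (*-identityˡ _)
    expansion-0s (suc s) k = begin
      ι (pfCoeff 0 (suc (suc s)) 0) * (A (suc (suc s)) * Z k) + antidiag s (λ a b → ι (pfCoeff 0 (suc (suc s)) (suc a)) * (A (suc b) * Z (suc a +ℕ k)))
        ≈⟨ +-cong (trans (*-congʳ (trans (reflexive (P.cong ι (pfCoeff-0s-0 (suc s)))) ι-1)) (*-identityˡ _))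
                  (antidiag-zero s _ (λ a b e → trans (*-congʳ (trans (reflexive (P.cong ι (pfCoeff-0s-suc (suc s) a (a+b≡r⇒a<1+r e)))) ι-0)) (zeroˡ _))) ⟩
      A (suc (suc s)) * Z k + 0# ≈⟨ +-identityʳ _ ⟩
      A (suc (suc s)) * Z k ∎

  -- In the application x v = 1/a, y v t = 1/(a + t), z t = 1/t (0 if t = 0) and δ t = [t = 0], where a = v + θ^d.
  module DoubleSum (ι : FC → Carrier)
    (ι-+ : ∀ a b → ι (a ⊕ b) ≈ ι a + ι b)
    (ι-⊖ : ∀ a → ι (⊖ a) ≈ - ι a)
    (ι-0 : ι 𝟘 ≈ 0#)
    (ι-1 : ι 𝟙 ≈ 1#)
    {V T : Set} (vs : List V) (ts : List T)
    (x : V → Carrier) (y : V → T → Carrier) (z : T → Carrier) (δ : T → Carrier)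
    (z-partialFraction : ∀ v t → v ∈ vs → t ∈ ts → z t * (x v * y v t) ≈ z t * (z t * (x v - y v t)))
    (xy-partialFraction : ∀ v t → v ∈ vs → t ∈ ts → x v * y v t ≈ δ t * (x v * x v) + z t * (x v - y v t))
    (δ-y≈x : ∀ v t → v ∈ vs → t ∈ ts → δ t * y v t ≈ δ t * x v)
    (y-translation : ∀ t → t ∈ ts → ∀ m → sumL vs (λ v → y v t ^ m) ≈ sumL vs (λ v → x v ^ m))
    (δ-sum : sumL ts δ ≈ 1#) where

    A : ℕ → Carrier
    A m = sumL vs (λ v → x v ^ m)
    Z : ℕ → Carrier
    Z k = sumL ts (λ t → z t ^ k)

    open Expansion ι ι-+ ι-⊖ ι-0 ι-1 A Z public

    doubleSum : ℕ → ℕ → ℕ → Carrier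
    doubleSum r s k = sumL vs (λ v → sumL ts (λ t → x v ^ r * y v t ^ s * z t ^ k))

    sum2-cong : ∀ {f g : V → T → Carrier} → (∀ v t → v ∈ vs → t ∈ ts → f v t ≈ g v t) →
      sumL vs (λ v → sumL ts (f v)) ≈ sumL vs (λ v → sumL ts (g v))
    sum2-cong h = sum-cong vs (λ v v∈ → sum-cong ts (λ t t∈ → h v t v∈ t∈))

    sum2-+ : ∀ (f g : V → T → Carrier) → sumL vs (λ v → sumL ts (λ t → f v t + g v t)) ≈ sumL vs (λ v → sumL ts (f v)) + sumL vs (λ v → sumL ts (g v))
    sum2-+ f g = trans (sum-cong' vs (λ v → sum-∙ ts (f v) (g v))) (sum-∙ vs _ _)

    sum2-neg : ∀ (f : V → T → Carrier) → sumL vs (λ v → sumL ts (λ t → - f v t)) ≈ - sumL vs (λ v → sumL ts (f v))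
    sum2-neg f = trans (sum-cong' vs (λ v → sym (sum-neg ts (f v)))) (sym (sum-neg vs _))

    doubleSum-r0 : ∀ r k → doubleSum r 0 k ≈ A r * Z k
    doubleSum-r0 r k = trans (sum-cong' vs (λ v → sum-cong' ts (λ t → *-congʳ (*-identityʳ _)))) (sym (sum-mul vs ts _ _))

    doubleSum-0s : ∀ s k → doubleSum 0 s k ≈ A s * Z k
    doubleSum-0s s k = begin
      doubleSum 0 s k ≈⟨ sum-cong' vs (λ v → sum-cong' ts (λ t → *-congʳ (*-identityˡ _))) ⟩
      sumL vs (λ v → sumL ts (λ t → y v t ^ s * z t ^ k)) ≈⟨ sum-swap vs ts _ ⟩
      sumL ts (λ t → sumL vs (λ v → y v t ^ s * z t ^ k)) ≈⟨ sum-cong' ts (λ t → sym (sum-*ʳ _ vs _)) ⟩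
      sumL ts (λ t → sumL vs (λ v → y v t ^ s) * z t ^ k) ≈⟨ sum-cong ts (λ t t∈ → *-congʳ (y-translation t t∈ s)) ⟩
      sumL ts (λ t → A s * z t ^ k) ≈⟨ sym (sum-*ˡ _ ts _) ⟩
      A s * Z k ∎

    private
      neg-pull : ∀ X u Y Q → X * (- u * Y) * Q ≈ - (X * (u * Y) * Q)
      neg-pull X u Y Q = begin
        X * (- u * Y) * Q ≈⟨ *-congʳ (*-congˡ (sym (-‿distribˡ-* u Y))) ⟩
        X * (- (u * Y)) * Q ≈⟨ *-congʳ (sym (-‿distribʳ-* X _)) ⟩
        - (X * (u * Y)) * Q ≈⟨ sym (-‿distribˡ-* _ Q) ⟩
        - (X * (u * Y) * Q) ∎

    doubleSum-pascal-term : ∀ r s k v t → v ∈ vs → t ∈ ts →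
      x v ^ suc r * y v t ^ suc s * z t ^ suc k ≈ x v ^ suc r * y v t ^ s * z t ^ suc (suc k) + - (x v ^ r * y v t ^ suc s * z t ^ suc (suc k))
    doubleSum-pascal-term r s k v t v∈ t∈ = begin
      (xx * X) * (yy * Y) * (zz * Q)
        ≈⟨ solve 6 (λ xx X yy Y zz Q → (xx :* X) :* (yy :* Y) :* (zz :* Q) := X :* Y :* Q :* (zz :* (xx :* yy))) refl xx X yy Y zz Q ⟩
      X * Y * Q * (zz * (xx * yy)) ≈⟨ *-congˡ (z-partialFraction v t v∈ t∈) ⟩
      X * Y * Q * (zz * (zz * (xx + - yy)))
        ≈⟨ solve 7 (λ xx X nyy Y zz Q yy → X :* Y :* Q :* (zz :* (zz :* (xx :+ nyy))) := (xx :* X) :* Y :* (zz :* (zz :* Q)) :+ X :* (nyy :* Y) :* (zz :* (zz :* Q))) refl xx X (- yy) Y zz Q yy ⟩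
      (xx * X) * Y * (zz * (zz * Q)) + X * (- yy * Y) * (zz * (zz * Q)) ≈⟨ +-congˡ (neg-pull X yy Y _) ⟩
      (xx * X) * Y * (zz * (zz * Q)) + - (X * (yy * Y) * (zz * (zz * Q))) ∎
      where
      xx X yy Y zz Q : Carrier
      xx = x v
      X = x v ^ r
      yy = y v t
      Y = y v t ^ s
      zz = z t
      Q = z t ^ k

    doubleSum-pascal : ∀ r s k → doubleSum (suc r) (suc s) (suc k) ≈ doubleSum (suc r) s (suc (suc k)) - doubleSum r (suc s) (suc (suc k))
    doubleSum-pascal r s k = begin
      doubleSum (suc r) (suc s) (suc k) ≈⟨ sum2-cong (doubleSum-pascal-term r s k) ⟩
      sumL vs (λ v → sumL ts (λ t → x v ^ suc r * y v t ^ s * z t ^ suc (suc k) + - (x v ^ r * y v t ^ suc s * z t ^ suc (suc k))))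
        ≈⟨ sum2-+ _ _ ⟩
      doubleSum (suc r) s (suc (suc k)) + sumL vs (λ v → sumL ts (λ t → - (x v ^ r * y v t ^ suc s * z t ^ suc (suc k))))
        ≈⟨ +-congˡ (sum2-neg _) ⟩
      doubleSum (suc r) s (suc (suc k)) - doubleSum r (suc s) (suc (suc k)) ∎

    δ-pow : ∀ v t → v ∈ vs → t ∈ ts → ∀ n → δ t * y v t ^ n ≈ δ t * x v ^ n
    δ-pow v t v∈ t∈ zero = refl
    δ-pow v t v∈ t∈ (suc n) = begin
      δ t * (y v t * y v t ^ n) ≈⟨ sym (*-assoc _ _ _) ⟩
      (δ t * y v t) * y v t ^ n ≈⟨ *-congʳ (δ-y≈x v t v∈ t∈) ⟩
      (δ t * x v) * y v t ^ n ≈⟨ solve 3 (λ d a b → (d :* a) :* b := a :* (d :* b)) refl (δ t) (x v) _ ⟩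
      x v * (δ t * y v t ^ n) ≈⟨ *-congˡ (δ-pow v t v∈ t∈ n) ⟩
      x v * (δ t * x v ^ n) ≈⟨ solve 3 (λ d a b → a :* (d :* b) := d :* (a :* b)) refl (δ t) (x v) _ ⟩
      δ t * (x v * x v ^ n) ∎

    doubleSum-00-term : ∀ r s v t → v ∈ vs → t ∈ ts →
      x v ^ suc r * y v t ^ suc s * z t ^ 0
        ≈ δ t * x v ^ (suc r +ℕ suc s) + (x v ^ suc r * y v t ^ s * z t ^ 1 + - (x v ^ r * y v t ^ suc s * z t ^ 1))
    doubleSum-00-term r s v t v∈ t∈ = begin
      (xx * X) * (yy * Y) * 1#
        ≈⟨ solve 4 (λ xx X yy Y → (xx :* X) :* (yy :* Y) :* con 1 := X :* Y :* (xx :* yy)) refl xx X yy Y ⟩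
      X * Y * (xx * yy) ≈⟨ *-congˡ (xy-partialFraction v t v∈ t∈) ⟩
      X * Y * (dd * (xx * xx) + zz * (xx + - yy))
        ≈⟨ solve 7 (λ X Y dd xx zz nyy yy → X :* Y :* (dd :* (xx :* xx) :+ zz :* (xx :+ nyy))
                  := xx :* (xx :* X) :* (dd :* Y) :+ ((xx :* X) :* Y :* (zz :* con 1) :+ X :* (nyy :* Y) :* (zz :* con 1))) refl X Y dd xx zz (- yy) yy ⟩
      xx * (xx * X) * (dd * Y) + ((xx * X) * Y * (zz * 1#) + X * (- yy * Y) * (zz * 1#))
        ≈⟨ +-cong δ-part (+-congˡ (neg-pull X yy Y _)) ⟩
      dd * xx ^ (suc r +ℕ suc s) + ((xx * X) * Y * (zz * 1#) + - (X * (yy * Y) * (zz * 1#))) ∎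
      where
      xx X yy Y zz dd : Carrier
      xx = x v
      X = x v ^ r
      yy = y v t
      Y = y v t ^ s
      zz = z t
      dd = δ t
      δ-part : xx * (xx * X) * (dd * Y) ≈ dd * xx ^ (suc r +ℕ suc s)
      δ-part = begin
        xx * (xx * X) * (dd * Y) ≈⟨ *-congˡ (δ-pow v t v∈ t∈ s) ⟩
        xx * (xx * X) * (dd * xx ^ s)
          ≈⟨ solve 4 (λ xx X dd S → xx :* (xx :* X) :* (dd :* S) := dd :* ((xx :* X) :* (xx :* S))) refl xx X dd (xx ^ s) ⟩
        dd * (xx ^ (suc r) * xx ^ (suc s)) ≈⟨ *-congˡ (sym (^-homo-* xx (suc r) (suc s))) ⟩
        dd * xx ^ (suc r +ℕ suc s) ∎

    sum-δ-weighted : ∀ n → sumL vs (λ v → sumL ts (λ t → δ t * x v ^ n)) ≈ A n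
    sum-δ-weighted n = begin
      sumL vs (λ v → sumL ts (λ t → δ t * x v ^ n))
        ≈⟨ sum-cong' vs (λ v → trans (sum-cong' ts (λ t → *-comm _ _)) (sym (sum-*ˡ _ ts δ))) ⟩
      sumL vs (λ v → x v ^ n * sumL ts δ)
        ≈⟨ sum-cong' vs (λ v → trans (*-congˡ δ-sum) (*-identityʳ _)) ⟩
      A n ∎

    doubleSum-00 : ∀ r s → doubleSum (suc r) (suc s) 0 ≈ A (suc r +ℕ suc s) + (doubleSum (suc r) s 1 - doubleSum r (suc s) 1)
    doubleSum-00 r s = begin
      doubleSum (suc r) (suc s) 0 ≈⟨ sum2-cong (doubleSum-00-term r s) ⟩
      sumL vs (λ v → sumL ts (λ t → δ t * x v ^ (suc r +ℕ suc s)
           + (x v ^ suc r * y v t ^ s * z t ^ 1 + - (x v ^ r * y v t ^ suc s * z t ^ 1))))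
        ≈⟨ sum2-+ _ _ ⟩
      sumL vs (λ v → sumL ts (λ t → δ t * x v ^ (suc r +ℕ suc s)))
        + sumL vs (λ v → sumL ts (λ t → x v ^ suc r * y v t ^ s * z t ^ 1 + - (x v ^ r * y v t ^ suc s * z t ^ 1)))
        ≈⟨ +-cong (sum-δ-weighted (suc r +ℕ suc s)) (trans (sum2-+ _ _) (+-congˡ (sum2-neg _))) ⟩
      A (suc r +ℕ suc s) + (doubleSum (suc r) s 1 - doubleSum r (suc s) 1) ∎

    doubleSum≈expansion : ∀ r s k N → r +ℕ s ≡ suc N → doubleSum r s (suc k) ≈ expansion N r s (suc k)
    doubleSum≈expansion zero zero k N ()
    doubleSum≈expansion (suc r) zero k N e with P.trans (P.sym (ℕP.+-identityʳ r)) (ℕP.suc-injective e)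
    ... | P.refl = trans (doubleSum-r0 (suc r) (suc k)) (sym (expansion-r0 r (suc k)))
    doubleSum≈expansion zero (suc s) k N e with ℕP.suc-injective e
    ... | P.refl = trans (doubleSum-0s (suc s) (suc k)) (sym (expansion-0s s (suc k)))
    doubleSum≈expansion (suc r) (suc s) k N e with P.trans (P.sym (ℕP.+-suc r s)) (ℕP.suc-injective e)
    ... | P.refl = begin
      doubleSum (suc r) (suc s) (suc k) ≈⟨ doubleSum-pascal r s k ⟩
      doubleSum (suc r) s (suc (suc k)) - doubleSum r (suc s) (suc (suc k))
        ≈⟨ +-cong (doubleSum≈expansion (suc r) s (suc k) (r +ℕ s) P.refl) (-‿cong (doubleSum≈expansion r (suc s) (suc k) (r +ℕ s) (ℕP.+-suc r s))) ⟩
      expansion (r +ℕ s) (suc r) s (suc (suc k)) - expansion (r +ℕ s) r (suc s) (suc (suc k)) ≈⟨ sym (expansion-pascal (r +ℕ s) r s (suc k)) ⟩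
      expansion (suc (r +ℕ s)) (suc r) (suc s) (suc k) ∎

    doubleSum-expansion : ∀ r s → doubleSum (suc r) (suc s) 0 ≈ A (suc r +ℕ suc s) + expansion (suc (r +ℕ s)) (suc r) (suc s) 0
    doubleSum-expansion r s = begin
      doubleSum (suc r) (suc s) 0 ≈⟨ doubleSum-00 r s ⟩
      A (suc r +ℕ suc s) + (doubleSum (suc r) s 1 - doubleSum r (suc s) 1)
        ≈⟨ +-congˡ (+-cong (doubleSum≈expansion (suc r) s 0 (r +ℕ s) P.refl) (-‿cong (doubleSum≈expansion r (suc s) 0 (r +ℕ s) (ℕP.+-suc r s)))) ⟩
      A (suc r +ℕ suc s) + (expansion (r +ℕ s) (suc r) s 1 - expansion (r +ℕ s) r (suc s) 1) ≈⟨ +-congˡ (sym (expansion-pascal (r +ℕ s) r s 0)) ⟩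
      A (suc r +ℕ suc s) + expansion (suc (r +ℕ s)) (suc r) (suc s) 0 ∎


module CoefficientListSums (𝔽 : FiniteField) (R : CommutativeRing 0ℓ 0ℓ) where

  import Defs as D
  open import Data.Nat using (ℕ; zero; suc)
  open import Data.List using (List; []; _∷_; _++_; [_]; map; length)
  open import Data.List.Relation.Unary.All as All using (All; []; _∷_)
  import Data.List.Relation.Unary.All.Properties as AllP
  open import Relation.Binary.PropositionalEquality as P using (_≡_; _≢_)
  open import Relation.Nullary using (yes; no; does)
  open import Data.Bool using (if_then_else_)
  open FieldProperties 𝔽 renaming (Carrier to FC) using (_⊕_; _⊗_; ⊖_; 𝟘; 𝟙; elements; elements-unique; elements-complete; _≟_; inv; inv-correct; ⊗-assoc; ⊗-comm; ⊗-idˡ; ⊕-assoc; ⊕-idˡ; ⊖-invˡ; ⊖-invʳ)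
  open Polynomial 𝔽 using (Pol; addP; scaleP)
  open Cancellation 𝔽 using (zero?)
  open CommutativeRing R hiding (zero)
  open RingListSum R
  open import Relation.Binary.Reasoning.Setoid setoid

  -- L d lists the polynomials of degree < d, and v ↦ v ++ [ 𝟙 ] lists A_{d+}.
  L : ℕ → List Pol
  L = D.coeffLists 𝔽

  sum-L-∷ : ∀ n (f : Pol → Carrier) → sumL (L (suc n)) f ≈ sumL elements (λ c → sumL (L n) (λ v → f (c ∷ v)))
  sum-L-∷ n f = trans (sum-concatMap (λ c → map (c ∷_) (L n)) elements f)
    (sum-cong' elements (λ c → reflexive (sum-map (c ∷_) (L n) f)))

  L-length : ∀ n → All (λ v → length v ≡ n) (L n)
  L-length zero = P.refl ∷ []
  L-length (suc n) = AllP.concat⁺ (AllP.map⁺ {f = λ c → map (c ∷_) (L n)} (All.tabulate {xs = elements} (λ {c} _ → AllP.map⁺ {f = c ∷_} (All.map (P.cong suc) (L-length n)))))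

  sum-translate : ∀ n (w : Pol) → length w ≡ n → (f : Pol → Carrier) → sumL (L n) (λ v → f (addP w v)) ≈ sumL (L n) f
  sum-translate zero [] e f = refl
  sum-translate (suc n) (w0 ∷ w') e f = begin
    sumL (L (suc n)) (λ v → f (addP (w0 ∷ w') v)) ≈⟨ sum-L-∷ n _ ⟩
    sumL elements (λ c → sumL (L n) (λ v → f ((w0 ⊕ c) ∷ addP w' v)))
      ≈⟨ sum-cong' elements (λ c → sum-translate n w' (ℕP.suc-injective e) (λ u → f ((w0 ⊕ c) ∷ u))) ⟩
    sumL elements (λ c → sumL (L n) (λ v → f ((w0 ⊕ c) ∷ v)))
      ≈⟨ sum-bij elements elements-unique elements-complete (w0 ⊕_) (⊖ w0 ⊕_) τσ στ (λ c → sumL (L n) (λ v → f (c ∷ v))) ⟩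
    sumL elements (λ c → sumL (L n) (λ v → f (c ∷ v))) ≈⟨ sym (sum-L-∷ n f) ⟩
    sumL (L (suc n)) f ∎
    where
    import Data.Nat.Properties as ℕP
    τσ : ∀ x → ⊖ w0 ⊕ (w0 ⊕ x) ≡ x
    τσ x = P.trans (P.sym (⊕-assoc _ _ _)) (P.trans (P.cong (_⊕ x) (⊖-invˡ w0)) (⊕-idˡ x))
    στ : ∀ x → w0 ⊕ (⊖ w0 ⊕ x) ≡ x
    στ x = P.trans (P.sym (⊕-assoc _ _ _)) (P.trans (P.cong (_⊕ x) (⊖-invʳ w0)) (⊕-idˡ x))

  sum-scale : ∀ n (c : FC) → c ≢ 𝟘 → (f : Pol → Carrier) → sumL (L n) (λ v → f (scaleP c v)) ≈ sumL (L n) f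
  sum-scale zero c c0 f = refl
  sum-scale (suc n) c c0 f = begin
    sumL (L (suc n)) (λ v → f (scaleP c v)) ≈⟨ sum-L-∷ n _ ⟩
    sumL elements (λ a → sumL (L n) (λ v → f ((c ⊗ a) ∷ scaleP c v)))
      ≈⟨ sum-cong' elements (λ a → sum-scale n c c0 (λ u → f ((c ⊗ a) ∷ u))) ⟩
    sumL elements (λ a → sumL (L n) (λ v → f ((c ⊗ a) ∷ v)))
      ≈⟨ sum-bij elements elements-unique elements-complete (c ⊗_) (inv c ⊗_) τσ στ (λ a → sumL (L n) (λ v → f (a ∷ v))) ⟩
    sumL elements (λ a → sumL (L n) (λ v → f (a ∷ v))) ≈⟨ sym (sum-L-∷ n f) ⟩
    sumL (L (suc n)) f ∎
    where
    cc : c ⊗ inv c ≡ 𝟙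
    cc = inv-correct c c0
    τσ : ∀ x → inv c ⊗ (c ⊗ x) ≡ x
    τσ x = P.trans (P.sym (⊗-assoc _ _ _)) (P.trans (P.cong (_⊗ x) (P.trans (⊗-comm _ _) cc)) (⊗-idˡ x))
    στ : ∀ x → c ⊗ (inv c ⊗ x) ≡ x
    στ x = P.trans (P.sym (⊗-assoc _ _ _)) (P.trans (P.cong (_⊗ x) cc) (⊗-idˡ x))

  sum-L-∷ʳ : ∀ n (f : Pol → Carrier) → sumL (L (suc n)) f ≈ sumL elements (λ c → sumL (L n) (λ v → f (v ++ [ c ])))
  sum-L-∷ʳ zero f = trans (sum-L-∷ zero f) (sum-cong' elements (λ c → refl))
  sum-L-∷ʳ (suc n) f = begin
    sumL (L (suc (suc n))) f ≈⟨ sum-L-∷ (suc n) f ⟩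
    sumL elements (λ c0 → sumL (L (suc n)) (λ u → f (c0 ∷ u))) ≈⟨ sum-cong' elements (λ c0 → sum-L-∷ʳ n (λ u → f (c0 ∷ u))) ⟩
    sumL elements (λ c0 → sumL elements (λ c → sumL (L n) (λ v → f (c0 ∷ v ++ [ c ])))) ≈⟨ sum-swap elements elements _ ⟩
    sumL elements (λ c → sumL elements (λ c0 → sumL (L n) (λ v → f (c0 ∷ v ++ [ c ])))) ≈⟨ sum-cong' elements (λ c → sym (sum-L-∷ n (λ u → f (u ++ [ c ])))) ⟩
    sumL elements (λ c → sumL (L (suc n)) (λ u → f (u ++ [ c ]))) ∎

  module Ind = Indicator _≟_

  sum-zero-indicator : ∀ n (X : Carrier) → sumL (L n) (λ t → if does (zero? t) then X else 0#) ≈ X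
  sum-zero-indicator zero X = +-identityʳ X
  sum-zero-indicator (suc n) X = begin
    sumL (L (suc n)) (λ t → if does (zero? t) then X else 0#) ≈⟨ sum-L-∷ n _ ⟩
    sumL elements (λ c → sumL (L n) (λ v → if does (zero? (c ∷ v)) then X else 0#)) ≈⟨ sum-cong' elements termwise ⟩
    sumL elements (λ c → if does (c ≟ 𝟘) then sumL (L n) (λ v → if does (zero? v) then X else 0#) else 0#)
      ≈⟨ Ind.sum-indicator-∈ elements elements-unique 𝟘 (λ _ → sumL (L n) (λ v → if does (zero? v) then X else 0#)) (elements-complete 𝟘) ⟩
    sumL (L n) (λ v → if does (zero? v) then X else 0#) ≈⟨ sum-zero-indicator n X ⟩
    X ∎
    where
    termwise : ∀ c → sumL (L n) (λ v → if does (zero? (c ∷ v)) then X else 0#) ≈ (if does (c ≟ 𝟘) then sumL (L n) (λ v → if does (zero? v) then X else 0#) else 0#)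
    termwise c with c ≟ 𝟘
    ... | yes _ = refl
    ... | no _ = sum-ε (L n)


module Reciprocals (𝔽 : FiniteField) where

  open import Data.Nat using (zero; suc)
  import Data.Nat.Properties as ℕP
  open import Data.List using (List; []; _∷_; _++_; [_]; length)
  open import Data.List.Relation.Unary.All as All using (All; []; _∷_)
  import Data.List.Relation.Unary.All.Properties as AllP
  import Data.List.Properties as LP
  open import Relation.Binary.PropositionalEquality as P using (_≡_; _≢_)
  open import Relation.Nullary using (yes; no; does; ¬_)
  open import Data.Bool using (if_then_else_)
  open import Data.Empty using (⊥-elim)
  open import Algebra.Bundles using (CommutativeRing)
  open FieldProperties 𝔽 renaming (Carrier to FC)
  open Polynomial 𝔽 using (Pol; addP; mulP; scaleP; oneP; mulP-singleton; [𝟘]≈[]; cons-cong; ≈-refl; ≈-sym; ≈-trans) renaming (_≈_ to _≈p_)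
  open Cancellation 𝔽 using (cancellable-∷ʳ; cancellable-nonzero; cancellable-one; zero?; allZ⇒≈; ≈⇒allZ)
  open Fraction 𝔽
  open CommutativeRing fracRing hiding (zero)
  open RingListSum fracRing

  ι : FC → K
  ι c = [ c ] / oneP [ cancellable-one ]

  private
    module PSol = PS.Solver

  ι-+ : ∀ a b → ι (a ⊕ b) ≈ ι a + ι b
  ι-+ a b = mk≃ (rebracket [ a ] [ b ] oneP)
    where
    rebracket : ∀ u v o → PR._*_ (PR._+_ u v) (PR._*_ o o) PR.≈ PR._*_ (PR._+_ (PR._*_ u o) (PR._*_ v o)) o
    rebracket = PSol.solve 3 (λ u v o → (u PSol.:+ v) PSol.:* (o PSol.:* o) PSol.:= (u PSol.:* o PSol.:+ v PSol.:* o) PSol.:* o) PR.refl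

  ι-⊗ : ∀ a b → ι (a ⊗ b) ≈ ι a * ι b
  -- scaleP a [ b ] reduces to [ a ⊗ b ], the numerator of ι (a ⊗ b).
  ι-⊗ a b = mk≃ (PR.trans (PR.*-congʳ {PR._*_ oneP oneP} (PR.sym (mulP-singleton a [ b ]))) (PR.*-congˡ {mulP [ a ] [ b ]} (PR.*-identityʳ oneP)))

  ι-⊖ : ∀ a → ι (⊖ a) ≈ - ι a
  ι-⊖ a = mk≃ PR.refl

  ι-0 : ι 𝟘 ≈ 0#
  ι-0 = mk≃ (PR.*-congʳ {oneP} {[ 𝟘 ]} {[]} [𝟘]≈[])

  ι-1 : ι 𝟙 ≈ 1#
  ι-1 = mk≃ PR.refl

  ι-pow : ∀ a n → ι a ^ n ≈ ι (powF a n)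
  ι-pow a zero = sym ι-1
  ι-pow a (suc n) = trans (*-congˡ {ι a} (ι-pow a n)) (sym (ι-⊗ a (powF a n)))

  ι-cong : ∀ {a b} → a ≡ b → ι a ≈ ι b
  ι-cong P.refl = refl

  module FS = RingListSum fieldRing
  ι-sum : {A : Set} (xs : List A) (f : A → FC) → sumL xs (λ x → ι (f x)) ≈ ι (FS.sumL xs f)
  ι-sum [] f = sym ι-0
  ι-sum (x ∷ xs) f = trans (+-congˡ {ι (f x)} (ι-sum xs f)) (sym (ι-+ (f x) (FS.sumL xs f)))

  recipMonic : Pol → K
  recipMonic v = oneP / (v ++ [ 𝟙 ]) [ cancellable-∷ʳ v 𝟙 𝟙≢𝟘 ]

  recipMonic-cong : ∀ {a b} → (a ++ [ 𝟙 ]) ≈p (b ++ [ 𝟙 ]) → recipMonic a ≈ recipMonic b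
  recipMonic-cong e = mk≃ (PR.*-congˡ {oneP} (PR.sym e))

  -- The junk value recip 𝟘 = 0 is harmless: the terms with t = 0 are weighted by isZero instead.
  recip : Pol → K
  recip t with zero? t
  ... | yes _ = 0#
  ... | no nz = oneP / t [ cancellable-nonzero t nz ]

  isZero : Pol → K
  isZero t = if does (zero? t) then 1# else 0#

  recip-cong : ∀ {t t'} → t ≈p t' → recip t ≈ recip t'
  recip-cong {t} {t'} e with zero? t | zero? t'
  ... | yes _ | yes _ = refl
  ... | no _ | no _ = mk≃ (PR.*-congˡ {oneP} (PR.sym e))
  ... | yes z | no nz = ⊥-elim (nz (≈⇒allZ (≈-trans (≈-sym e) (allZ⇒≈ z))))
  ... | no nz | yes z = ⊥-elim (nz (≈⇒allZ (≈-trans e (allZ⇒≈ z))))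

  addP-zeros-∷ʳ : ∀ (t v : Pol) c → length t ≡ length v → All (_≡ 𝟘) t → (addP t v ++ [ c ]) ≈p (v ++ [ c ])
  addP-zeros-∷ʳ [] [] c e z = ≈-refl
  addP-zeros-∷ʳ (a ∷ t) (b ∷ v) c e (a0 ∷ z) = cons-cong (P.trans (P.cong (_⊕ b) a0) (⊕-idˡ b)) (addP-zeros-∷ʳ t v c (ℕP.suc-injective e) z)

  addP-∷ʳ : ∀ (t v : Pol) c → length t ≡ length v → (addP t v ++ [ c ]) ≈p addP t (v ++ [ c ])
  addP-∷ʳ [] [] c e = ≈-refl
  addP-∷ʳ (a ∷ t) (b ∷ v) c e = cons-cong P.refl (addP-∷ʳ t v c (ℕP.suc-injective e))

  addP-comm-∷ʳ : ∀ (t v : Pol) c → length t ≡ length v → (addP t v ++ [ c ]) ≈p (addP v t ++ [ c ])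
  addP-comm-∷ʳ [] [] c e = ≈-refl
  addP-comm-∷ʳ (a ∷ t) (b ∷ v) c e = cons-cong (⊕-comm a b) (addP-comm-∷ʳ t v c (ℕP.suc-injective e))

  partialFraction : ∀ (t v : Pol) → length t ≡ length v → (nz : ¬ All (_≡ 𝟘) t) →
    recipMonic v * recipMonic (addP t v) ≈ (oneP / t [ cancellable-nonzero t nz ]) * (recipMonic v - recipMonic (addP t v))
  partialFraction t v e nz = mk≃ goal
    where
    a b : Pol
    a = v ++ [ 𝟙 ]
    b = addP t v ++ [ 𝟙 ]
    b≈ : b ≈p PR._+_ t a
    b≈ = addP-∷ʳ t v 𝟙 e
    open PR using () renaming (_+_ to _⊞_; _*_ to _⊠_; -_ to ⊟_; 1# to 𝟏)
    diff : (𝟏 ⊠ b ⊞ (⊟ 𝟏) ⊠ a) PR.≈ t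
    diff = PR.trans (PR.+-cong (PR.*-identityˡ b) (PS.-1*x≈-x a)) (PR.trans (PR.+-congʳ {⊟ a} b≈)
             (PR.trans (PR.+-assoc t a (⊟ a)) (PR.trans (PR.+-congˡ {t} (PR.-‿inverseʳ a)) (PR.+-identityʳ t))))
    goal : ((𝟏 ⊠ 𝟏) ⊠ (t ⊠ (a ⊠ b))) PR.≈ ((𝟏 ⊠ (𝟏 ⊠ b ⊞ (⊟ 𝟏) ⊠ a)) ⊠ (a ⊠ b))
    drop-𝟏 : ∀ t ab → ((𝟏 ⊠ 𝟏) ⊠ (t ⊠ ab)) PR.≈ ((𝟏 ⊠ t) ⊠ ab)
    drop-𝟏 = PSol.solve 2 (λ t ab → (PSol.con 1 PSol.:* PSol.con 1) PSol.:* (t PSol.:* ab) PSol.:= (PSol.con 1 PSol.:* t) PSol.:* ab) PR.refl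
    goal = PR.trans (drop-𝟏 t (a ⊠ b))
             (PR.*-congʳ {a ⊠ b} (PR.*-congˡ {𝟏} (PR.sym diff)))

  recip-∷ʳ : ∀ (v : Pol) c → c ≢ 𝟘 → recip (v ++ [ c ]) ≈ ι (inv c) * recipMonic (scaleP (inv c) v)
  recip-∷ʳ v c c0 with zero? (v ++ [ c ])
  ... | yes z = ⊥-elim (c0 (lastz (AllP.++⁻ʳ v z)))
    where lastz : All (_≡ 𝟘) [ c ] → c ≡ 𝟘
          lastz (p ∷ []) = p
  ... | no nz = mk≃ (PR.trans (PR.*-identityˡ _) (PR.trans e1 (PR.sym (PR.*-congʳ (PR.*-identityʳ [ inv c ])))))
    where
    w : Pol
    w = scaleP (inv c) v
    e0 : scaleP (inv c) (v ++ [ c ]) ≡ w ++ [ 𝟙 ]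
    e0 = P.trans (LP.map-++ (inv c ⊗_) v [ c ]) (P.cong (λ u → w ++ [ u ]) (P.trans (⊗-comm _ _) (inv-correct c c0)))
    e1 : PR._*_ oneP (w ++ [ 𝟙 ]) PR.≈ PR._*_ [ inv c ] (v ++ [ c ])
    e1 = PR.trans (PR.*-identityˡ _) (PR.trans (PR.reflexive (P.sym e0)) (PR.sym (mulP-singleton (inv c) (v ++ [ c ]))))


module PowerSumIdentity (𝔽 : FiniteField) where

  import Defs as D
  open import Data.Nat using (ℕ; zero; suc; _∸_) renaming (_+_ to _+ℕ_)
  import Data.Nat.Properties as ℕP
  open import Data.Nat.Divisibility using (_∣_; _∣?_)
  open import Data.List using (List; []; _∷_; _++_; [_]; map; length)
  open import Data.List.Relation.Unary.All as All using ([]; _∷_)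
  open import Data.List.Membership.Propositional using (_∈_)
  import Data.List.Properties as LP
  open import Relation.Binary.PropositionalEquality as P using (_≡_; _≢_)
  open import Relation.Nullary using (Dec; yes; no; does; ¬_)
  open import Data.Bool using (if_then_else_)
  open import Algebra.Bundles using (CommutativeRing)
  open FieldProperties 𝔽 renaming (Carrier to FC)
  open Polynomial 𝔽 using (Pol; addP; mulP; scaleP; oneP; polyRing; ≈-refl; ≈-trans) renaming (_≈_ to _≈p_)
  open Cancellation 𝔽 using (Cancellable; cancellable-∷ʳ; cancellable-one; cancellable-*; cancellable-nonzero; zero?; ∷ʳ-𝟘)
  open Fraction 𝔽
  open SignedBinomial 𝔽 using (pfCoeff; pfCoeff-0; pfCoeff≡Δ)
  open PowerSums 𝔽 using (invPowSum; invPowTerm; invPowSum≡; powF-mul; powF-one)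
  open Reciprocals 𝔽
  open CommutativeRing fracRing hiding (zero)
  open RingListSum fracRing
  open PartialFractionExpansion 𝔽 fracRing
  open CoefficientListSums 𝔽 fracRing
  open Solver using (solve; _:=_; _:*_)
  open import Relation.Binary.Reasoning.Setoid setoid

  powerSum : ℕ → ℕ → K
  powerSum d m = sumL (L d) (λ v → recipMonic v ^ m)

  recipPowerSum : ℕ → ℕ → K
  recipPowerSum d k = sumL (L d) (λ t → recip t ^ k)

  module MonicDoubleSum (d : ℕ) where
    L-length-≡ : ∀ {t v} → t ∈ L d → v ∈ L d → length t ≡ length v
    L-length-≡ t∈ v∈ = P.trans (All.lookup (L-length d) t∈) (P.sym (All.lookup (L-length d) v∈))

    x : Pol → K
    x = recipMonic
    y : Pol → Pol → K
    y v t = recipMonic (addP t v)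

    z-partialFraction : ∀ v t → v ∈ L d → t ∈ L d → recip t * (x v * y v t) ≈ recip t * (recip t * (x v - y v t))
    z-partialFraction v t v∈ t∈ with zero? t
    ... | yes _ = trans (zeroˡ (x v * y v t)) (sym (zeroˡ (0# * (x v - y v t))))
    ... | no nz = *-congˡ {oneP / t [ cancellable-nonzero t nz ]} (partialFraction t v (L-length-≡ t∈ v∈) nz)

    xy-partialFraction : ∀ v t → v ∈ L d → t ∈ L d → x v * y v t ≈ isZero t * (x v * x v) + recip t * (x v - y v t)
    xy-partialFraction v t v∈ t∈ with zero? t
    ... | yes z = begin
      x v * y v t ≈⟨ *-congˡ {x v} (recipMonic-cong (addP-zeros-∷ʳ t v 𝟙 (L-length-≡ t∈ v∈) z)) ⟩
      x v * x v ≈⟨ sym (*-identityˡ (x v * x v)) ⟩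
      1# * (x v * x v) ≈⟨ sym (+-identityʳ (1# * (x v * x v))) ⟩
      1# * (x v * x v) + 0# ≈⟨ +-congˡ {1# * (x v * x v)} (sym (zeroˡ (x v - y v t))) ⟩
      1# * (x v * x v) + 0# * (x v - y v t) ∎
    ... | no nz = begin
      x v * y v t ≈⟨ partialFraction t v (L-length-≡ t∈ v∈) nz ⟩
      t⁻¹ * (x v - y v t) ≈⟨ sym (+-identityˡ (t⁻¹ * (x v - y v t))) ⟩
      0# + t⁻¹ * (x v - y v t) ≈⟨ +-congʳ {t⁻¹ * (x v - y v t)} (sym (zeroˡ (x v * x v))) ⟩
      0# * (x v * x v) + t⁻¹ * (x v - y v t) ∎
      where
      t⁻¹ : K
      t⁻¹ = oneP / t [ cancellable-nonzero t nz ]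

    δ-y≈x : ∀ v t → v ∈ L d → t ∈ L d → isZero t * y v t ≈ isZero t * x v
    δ-y≈x v t v∈ t∈ with zero? t
    ... | yes z = *-congˡ {1#} (recipMonic-cong (addP-zeros-∷ʳ t v 𝟙 (L-length-≡ t∈ v∈) z))
    ... | no nz = trans (zeroˡ (y v t)) (sym (zeroˡ (x v)))

    y-translation : ∀ t → t ∈ L d → ∀ m → sumL (L d) (λ v → y v t ^ m) ≈ sumL (L d) (λ v → x v ^ m)
    y-translation t t∈ m = sum-translate d t (All.lookup (L-length d) t∈) (λ u → recipMonic u ^ m)

    δ-sum : sumL (L d) isZero ≈ 1#
    δ-sum = sum-zero-indicator d 1#

    open DoubleSum ι ι-+ ι-⊖ ι-0 ι-1 (L d) (L d) x y recip isZero z-partialFraction xy-partialFraction δ-y≈x y-translation δ-sum public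

    powerSum-product : ∀ r s → powerSum d r * powerSum d s ≈ doubleSum r s 0
    powerSum-product r s = begin
      powerSum d r * powerSum d s ≈⟨ sum-mul (L d) (L d) (λ v → recipMonic v ^ r) (λ w → recipMonic w ^ s) ⟩
      sumL (L d) (λ v → sumL (L d) (λ w → recipMonic v ^ r * recipMonic w ^ s))
        ≈⟨ sum-cong (L d) (λ v v∈ → sym (sum-translate d v (All.lookup (L-length d) v∈) (λ w → recipMonic v ^ r * recipMonic w ^ s))) ⟩
      sumL (L d) (λ v → sumL (L d) (λ t → recipMonic v ^ r * recipMonic (addP v t) ^ s))
        ≈⟨ sum-cong (L d) (λ v v∈ → sum-cong (L d) (λ t t∈ →
             trans (*-congˡ {recipMonic v ^ r} (^-congˡ s (recipMonic-cong (addP-comm-∷ʳ v t 𝟙 (L-length-≡ v∈ t∈))))) (sym (*-identityʳ (recipMonic v ^ r * recipMonic (addP t v) ^ s))))) ⟩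
      doubleSum r s 0 ∎

  cancellable-powP : ∀ a n → Cancellable a → Cancellable (D.powP 𝔽 a n)
  cancellable-powP a zero g = cancellable-one
  cancellable-powP a (suc n) g = cancellable-* g (cancellable-powP a n g)

  Sᴷ : ℕ → ℕ → FC → K
  Sᴷ d s ε = sumL (L d) (λ v → [ powF ε d ] / D.powP 𝔽 (v ++ [ 𝟙 ]) s [ cancellable-powP (v ++ [ 𝟙 ]) s (cancellable-∷ʳ v 𝟙 𝟙≢𝟘) ])

  S<ᴷ : ℕ → ℕ → FC → K
  S<ᴷ zero s ε = 0#
  S<ᴷ (suc d) s ε = Sᴷ d s ε + S<ᴷ d s ε

  frac-sum : ∀ {A : Set} (xs : List A) (f : A → K) → frac (sumL xs f) ≡ D.sumK 𝔽 (map (λ a → frac (f a)) xs)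
  frac-sum [] f = P.refl
  frac-sum (x ∷ xs) f = P.cong (D.addK 𝔽 (frac (f x))) (frac-sum xs f)

  frac-Sᴷ : ∀ d s ε → frac (Sᴷ d s ε) ≡ D.S₁ 𝔽 d s ε
  frac-Sᴷ d s ε = P.trans (frac-sum (L d) _) (P.cong (D.sumK 𝔽) (LP.map-∘ (L d)))

  frac-S<ᴷ : ∀ d s ε → frac (S<ᴷ d s ε) ≡ D.S₁< 𝔽 d s ε
  frac-S<ᴷ zero s ε = P.refl
  frac-S<ᴷ (suc d) s ε = P.cong₂ (D.addK 𝔽) (frac-Sᴷ d s ε) (frac-S<ᴷ d s ε)

  num-pow : ∀ v n → num (recipMonic v ^ n) ≡ D.powP 𝔽 oneP n
  num-pow v zero = P.refl
  num-pow v (suc n) = P.cong (mulP oneP) (num-pow v n)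

  den-pow : ∀ v n → den (recipMonic v ^ n) ≡ D.powP 𝔽 (v ++ [ 𝟙 ]) n
  den-pow v zero = P.refl
  den-pow v (suc n) = P.cong (mulP (v ++ [ 𝟙 ])) (den-pow v n)

  powP-one : ∀ n → D.powP 𝔽 oneP n ≈p oneP
  powP-one zero = ≈-refl
  powP-one (suc n) = ≈-trans (Polynomial.mul-idˡ 𝔽 _) (powP-one n)

  Sᴷ≈ι*powerSum : ∀ d s ε → Sᴷ d s ε ≈ ι (powF ε d) * powerSum d s
  Sᴷ≈ι*powerSum d s ε = trans (sum-cong' (L d) term≈) (sym (sum-*ˡ (ι (powF ε d)) (L d) (λ v → recipMonic v ^ s)))
    where
    e : FC
    e = powF ε d
    module PR' = CommutativeRing polyRing
    term≈ : ∀ v → ([ e ] / D.powP 𝔽 (v ++ [ 𝟙 ]) s [ cancellable-powP (v ++ [ 𝟙 ]) s (cancellable-∷ʳ v 𝟙 𝟙≢𝟘) ]) ≈ ι e * recipMonic v ^ s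
    term≈ v = mk≃ (PR'.trans (PR'.*-congˡ {[ e ]} (PR'.trans (PR'.*-identityˡ _) (PR'.reflexive (den-pow v s))))
                (PR'.sym (PR'.trans (PR'.*-congʳ {D.powP 𝔽 (v ++ [ 𝟙 ]) s} (PR'.trans (PR'.*-congˡ {[ e ]} (PR'.reflexive (num-pow v s))) (PR'.trans (PR'.*-congˡ {[ e ]} (powP-one s)) (PR'.*-identityʳ [ e ])))) PR'.refl)))

  Sᴷ-𝟙 : ∀ d s → Sᴷ d s 𝟙 ≈ powerSum d s
  Sᴷ-𝟙 d s = trans (Sᴷ≈ι*powerSum d s 𝟙) (trans (*-congʳ {powerSum d s} (trans (ι-cong (powF-one d)) ι-1)) (*-identityˡ (powerSum d s)))

  recipPowerSum-leading : ∀ d j c → c ≢ 𝟘 → sumL (L d) (λ v → recip (v ++ [ c ]) ^ j) ≈ ι (powF (inv c) j) * powerSum d j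
  recipPowerSum-leading d j c c≢𝟘 = begin
    sumL (L d) (λ v → recip (v ++ [ c ]) ^ j) ≈⟨ sum-cong' (L d) (λ v → ^-congˡ j (recip-∷ʳ v c c≢𝟘)) ⟩
    sumL (L d) (λ v → (ι (inv c) * recipMonic (scaleP (inv c) v)) ^ j) ≈⟨ sum-cong' (L d) (λ v → ^-distrib-* (ι (inv c)) (recipMonic (scaleP (inv c) v)) j) ⟩
    sumL (L d) (λ v → ι (inv c) ^ j * recipMonic (scaleP (inv c) v) ^ j) ≈⟨ sum-*ˡ (ι (inv c) ^ j) (L d) (λ v → recipMonic (scaleP (inv c) v) ^ j) ⟨
    ι (inv c) ^ j * sumL (L d) (λ v → recipMonic (scaleP (inv c) v) ^ j) ≈⟨ *-cong (ι-pow (inv c) j) (sum-scale d (inv c) (inv-nonzero c≢𝟘) (λ u → recipMonic u ^ j)) ⟩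
    ι (powF (inv c) j) * powerSum d j ∎

  recipPowerSum-suc : ∀ d j → recipPowerSum (suc d) j ≈ recipPowerSum d j + ι (invPowSum j) * powerSum d j
  recipPowerSum-suc d j = begin
    recipPowerSum (suc d) j ≈⟨ sum-L-∷ʳ d (λ t → recip t ^ j) ⟩
    sumL elements G ≈⟨ sum-cong' elements split ⟩
    sumL elements (λ c → (if does (c ≟ 𝟘) then G c else 0#) + (if does (c ≟ 𝟘) then 0# else G c))
      ≈⟨ sum-∙ elements (λ c → if does (c ≟ 𝟘) then G c else 0#) (λ c → if does (c ≟ 𝟘) then 0# else G c) ⟩
    sumL elements (λ c → if does (c ≟ 𝟘) then G c else 0#) + sumL elements (λ c → if does (c ≟ 𝟘) then 0# else G c)
      ≈⟨ +-cong leading-zero leading-nonzero ⟩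
    recipPowerSum d j + ι (invPowSum j) * powerSum d j ∎
    where
    G : FC → K
    G c = sumL (L d) (λ v → recip (v ++ [ c ]) ^ j)
    split : ∀ c → G c ≈ (if does (c ≟ 𝟘) then G c else 0#) + (if does (c ≟ 𝟘) then 0# else G c)
    split c with c ≟ 𝟘
    ... | yes _ = sym (+-identityʳ (G c))
    ... | no _ = sym (+-identityˡ (G c))
    leading-zero : sumL elements (λ c → if does (c ≟ 𝟘) then G c else 0#) ≈ recipPowerSum d j
    leading-zero = trans (Ind.sum-indicator-∈ elements elements-unique 𝟘 G (elements-complete 𝟘))
                         (sum-cong' (L d) (λ v → ^-congˡ j (recip-cong (∷ʳ-𝟘 v))))
    by-coefficient : ∀ c → (if does (c ≟ 𝟘) then 0# else G c) ≈ ι (invPowTerm j c) * powerSum d j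
    by-coefficient c with c ≟ 𝟘
    ... | yes _ = sym (trans (*-congʳ {powerSum d j} ι-0) (zeroˡ (powerSum d j)))
    ... | no c≢𝟘 = recipPowerSum-leading d j c c≢𝟘
    leading-nonzero : sumL elements (λ c → if does (c ≟ 𝟘) then 0# else G c) ≈ ι (invPowSum j) * powerSum d j
    leading-nonzero = begin
      sumL elements (λ c → if does (c ≟ 𝟘) then 0# else G c) ≈⟨ sum-cong' elements by-coefficient ⟩
      sumL elements (λ c → ι (invPowTerm j c) * powerSum d j) ≈⟨ sum-*ʳ (powerSum d j) elements (λ c → ι (invPowTerm j c)) ⟨
      sumL elements (λ c → ι (invPowTerm j c)) * powerSum d j ≈⟨ *-congʳ {powerSum d j} (ι-sum elements (invPowTerm j)) ⟩
      ι (invPowSum j) * powerSum d j ∎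

  recipPowerSum≈ : ∀ d j → recipPowerSum d (suc j) ≈ ι (invPowSum (suc j)) * S<ᴷ d (suc j) 𝟙
  recipPowerSum≈ zero j = begin
    0# ^ (suc j) + 0# ≈⟨ +-identityʳ (0# ^ (suc j)) ⟩
    0# * 0# ^ j ≈⟨ zeroˡ (0# ^ j) ⟩
    0# ≈⟨ sym (zeroʳ (ι (invPowSum (suc j)))) ⟩
    ι (invPowSum (suc j)) * 0# ∎
  recipPowerSum≈ (suc d) j = begin
    recipPowerSum (suc d) (suc j) ≈⟨ recipPowerSum-suc d (suc j) ⟩
    recipPowerSum d (suc j) + σ * powerSum d (suc j) ≈⟨ +-congʳ {σ * powerSum d (suc j)} (recipPowerSum≈ d j) ⟩
    σ * S<ᴷ d (suc j) 𝟙 + σ * powerSum d (suc j) ≈⟨ distribˡ σ (S<ᴷ d (suc j) 𝟙) (powerSum d (suc j)) ⟨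
    σ * (S<ᴷ d (suc j) 𝟙 + powerSum d (suc j)) ≈⟨ *-congˡ {σ} (+-comm (S<ᴷ d (suc j) 𝟙) (powerSum d (suc j))) ⟩
    σ * (powerSum d (suc j) + S<ᴷ d (suc j) 𝟙) ≈⟨ *-congˡ {σ} (+-congʳ {S<ᴷ d (suc j) 𝟙} (sym (Sᴷ-𝟙 d (suc j)))) ⟩
    σ * S<ᴷ (suc d) (suc j) 𝟙 ∎
    where
    σ : K
    σ = ι (invPowSum (suc j))

  LHSᴷ : ℕ → ℕ → ℕ → FC → FC → K
  LHSᴷ d s₁ s₂ ε₁ ε₂ = Sᴷ d s₁ ε₁ * Sᴷ d s₂ ε₂ - Sᴷ d (s₁ +ℕ s₂) (ε₁ ⊗ ε₂)

  RHSᴷ : ℕ → ℕ → ℕ → FC → FC → K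
  RHSᴷ d s₁ s₂ ε₁ ε₂ = sumL (D.admissibleJs 𝔽 (s₁ +ℕ s₂)) (λ j → ι (D.Δ 𝔽 s₁ s₂ j) * (Sᴷ d (s₁ +ℕ s₂ ∸ j) (ε₁ ⊗ ε₂) * S<ᴷ d j 𝟙))

  frac-LHSᴷ : ∀ d s₁ s₂ ε₁ ε₂ → frac (LHSᴷ d s₁ s₂ ε₁ ε₂) ≡ D.LHS 𝔽 d s₁ s₂ ε₁ ε₂
  frac-LHSᴷ d s₁ s₂ ε₁ ε₂ = P.cong₂ (D.addK 𝔽) (P.cong₂ (D.mulK 𝔽) (frac-Sᴷ d s₁ ε₁) (frac-Sᴷ d s₂ ε₂)) (P.cong (D.negK 𝔽) (frac-Sᴷ d (s₁ +ℕ s₂) (ε₁ ⊗ ε₂)))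

  frac-RHSᴷ : ∀ d s₁ s₂ ε₁ ε₂ → frac (RHSᴷ d s₁ s₂ ε₁ ε₂) ≡ D.RHS 𝔽 d s₁ s₂ ε₁ ε₂
  frac-RHSᴷ d s₁ s₂ ε₁ ε₂ = P.trans (frac-sum (D.admissibleJs 𝔽 (s₁ +ℕ s₂)) _)
    (P.cong (D.sumK 𝔽) (LP.map-cong (λ j → P.cong (D.mulK 𝔽 (D.constK 𝔽 (D.Δ 𝔽 s₁ s₂ j)))
      (P.cong₂ (D.mulK 𝔽) (frac-Sᴷ d (s₁ +ℕ s₂ ∸ j) (ε₁ ⊗ ε₂)) (frac-S<ᴷ d j 𝟙))) (D.admissibleJs 𝔽 (s₁ +ℕ s₂))))

  defectTerm : ℕ → ℕ → ℕ → ℕ → ℕ → K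
  defectTerm d r s a b = ι (pfCoeff (suc r) (suc s) (suc a)) * (powerSum d (suc b) * recipPowerSum d (suc a))

  powerSum-defect : ∀ d r s → powerSum d (suc r) * powerSum d (suc s) - powerSum d (suc r +ℕ suc s) ≈ antidiag (r +ℕ s) (defectTerm d r s)
  powerSum-defect d r s = begin
    A (suc r) * A (suc s) - A (suc r +ℕ suc s)
      ≈⟨ +-congʳ { - A (suc r +ℕ suc s) } (trans (powerSum-product (suc r) (suc s)) (doubleSum-expansion r s)) ⟩
    A (suc r +ℕ suc s) + expansion (suc (r +ℕ s)) (suc r) (suc s) 0 - A (suc r +ℕ suc s)
      ≈⟨ xyx⁻¹≈y (A (suc r +ℕ suc s)) _ ⟩
    ι (pfCoeff (suc r) (suc s) 0) * (A (suc (suc (r +ℕ s))) * Z 0) + antidiag (r +ℕ s) (λ a b → ι (pfCoeff (suc r) (suc s) (suc a)) * (A (suc b) * Z (suc a +ℕ 0)))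
      ≈⟨ +-cong (trans (*-congʳ {A (suc (suc (r +ℕ s))) * Z 0} (trans (ι-cong (pfCoeff-0 r s)) ι-0)) (zeroˡ (A (suc (suc (r +ℕ s))) * Z 0)))
                (antidiag-cong (r +ℕ s) (λ a b _ → *-congˡ {ι (pfCoeff (suc r) (suc s) (suc a))} (*-congˡ {A (suc b)} (reflexive (P.cong Z (ℕP.+-identityʳ (suc a))))))) ⟩
    0# + antidiag (r +ℕ s) (defectTerm d r s)
      ≈⟨ +-identityˡ _ ⟩
    antidiag (r +ℕ s) (defectTerm d r s) ∎
    where
    open MonicDoubleSum d using (A; Z; expansion; doubleSum-expansion; powerSum-product)
    open import Algebra.Properties.AbelianGroup +-abelianGroup using (xyx⁻¹≈y)

  LHSᴷ≈ι*defect : ∀ d r s ε₁ ε₂ →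
    LHSᴷ d (suc r) (suc s) ε₁ ε₂ ≈ ι (powF (ε₁ ⊗ ε₂) d) * (powerSum d (suc r) * powerSum d (suc s) - powerSum d (suc r +ℕ suc s))
  LHSᴷ≈ι*defect d r s ε₁ ε₂ = begin
    Sᴷ d s₁ ε₁ * Sᴷ d s₂ ε₂ - Sᴷ d (s₁ +ℕ s₂) (ε₁ ⊗ ε₂)
      ≈⟨ +-cong (*-cong (Sᴷ≈ι*powerSum d s₁ ε₁) (Sᴷ≈ι*powerSum d s₂ ε₂)) (-‿cong (Sᴷ≈ι*powerSum d (s₁ +ℕ s₂) (ε₁ ⊗ ε₂))) ⟩
    (ι e₁ * A s₁) * (ι e₂ * A s₂) - ι e * A (s₁ +ℕ s₂)
      ≈⟨ +-congʳ { - (ι e * A (s₁ +ℕ s₂)) } (trans (interchange (ι e₁) (A s₁) (ι e₂) (A s₂)) (*-congʳ {A s₁ * A s₂} (trans (sym (ι-⊗ e₁ e₂)) (ι-cong (P.sym (powF-mul ε₁ ε₂ d)))))) ⟩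
    ι e * (A s₁ * A s₂) - ι e * A (s₁ +ℕ s₂)
      ≈⟨ +-congˡ {ι e * (A s₁ * A s₂)} (-‿distribʳ-* (ι e) (A (s₁ +ℕ s₂))) ⟩
    ι e * (A s₁ * A s₂) + ι e * (- A (s₁ +ℕ s₂))
      ≈⟨ distribˡ (ι e) (A s₁ * A s₂) (- A (s₁ +ℕ s₂)) ⟨
    ι e * (A s₁ * A s₂ - A (s₁ +ℕ s₂)) ∎
    where
    open import Algebra.Properties.CommutativeSemigroup *-commutativeSemigroup using (interchange)
    A : ℕ → K
    A = powerSum d
    s₁ s₂ : ℕ
    s₁ = suc r
    s₂ = suc s
    e₁ e₂ e : FC
    e₁ = powF ε₁ d
    e₂ = powF ε₂ d
    e = powF (ε₁ ⊗ ε₂) d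

  admissibleTerm : ℕ → ℕ → ℕ → FC → FC → ℕ → K
  admissibleTerm d s₁ s₂ ε₁ ε₂ j =
    if does (card ∸ 1 ∣? j) then ι (D.Δ 𝔽 s₁ s₂ j) * (Sᴷ d (s₁ +ℕ s₂ ∸ j) (ε₁ ⊗ ε₂) * S<ᴷ d j 𝟙) else 0#

  admissibleTerm≈ : ∀ d r s ε₁ ε₂ a b → a +ℕ b ≡ r +ℕ s →
    admissibleTerm d (suc r) (suc s) ε₁ ε₂ (suc a) ≈ ι (powF (ε₁ ⊗ ε₂) d) * defectTerm d r s a b
  admissibleTerm≈ d r s ε₁ ε₂ a b a+b≡r+s = begin
    admissibleTerm d (suc r) (suc s) ε₁ ε₂ (suc a) ≈⟨ by-divisibility (card ∸ 1 ∣? suc a) ⟩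
    ι (c ⊗ (if does (card ∸ 1 ∣? suc a) then ⊖ 𝟙 else 𝟘)) * X ≈⟨ *-congʳ {X} (ι-cong (P.cong (c ⊗_) (P.sym (invPowSum≡ (suc a))))) ⟩
    ι (c ⊗ invPowSum (suc a)) * X ≈⟨ *-congʳ {X} (ι-⊗ c (invPowSum (suc a))) ⟩
    (ι c * ι (invPowSum (suc a))) * X ≈⟨ solve 5 (λ c σ e A B → (c :* σ) :* (e :* A :* B) := e :* (c :* (A :* (σ :* B)))) refl (ι c) (ι (invPowSum (suc a))) (ι e) (powerSum d (suc b)) B ⟩
    ι e * (ι c * (powerSum d (suc b) * (ι (invPowSum (suc a)) * B))) ≈⟨ *-congˡ {ι e} (*-congˡ {ι c} (*-congˡ {powerSum d (suc b)} (sym (recipPowerSum≈ d a)))) ⟩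
    ι e * defectTerm d r s a b ∎
    where
    e c : FC
    e = powF (ε₁ ⊗ ε₂) d
    c = pfCoeff (suc r) (suc s) (suc a)
    B X : K
    B = S<ᴷ d (suc a) 𝟙
    X = ι e * powerSum d (suc b) * B
    index : suc r +ℕ suc s ∸ suc a ≡ suc b
    index = P.trans (P.cong (_∸ a) (P.trans (ℕP.+-suc r s) (P.trans (P.cong suc (P.sym a+b≡r+s)) (P.sym (ℕP.+-suc a b))))) (ℕP.m+n∸m≡n a (suc b))
    by-divisibility : (dv : Dec (card ∸ 1 ∣ suc a)) →
      (if does dv then ι (D.Δ 𝔽 (suc r) (suc s) (suc a)) * (Sᴷ d (suc r +ℕ suc s ∸ suc a) (ε₁ ⊗ ε₂) * B) else 0#)
        ≈ ι (c ⊗ (if does dv then ⊖ 𝟙 else 𝟘)) * X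
    by-divisibility (yes q-1∣j) = *-cong (ι-cong (P.sym (pfCoeff≡Δ r s a q-1∣j)))
      (*-congʳ {B} (trans (Sᴷ≈ι*powerSum d (suc r +ℕ suc s ∸ suc a) (ε₁ ⊗ ε₂)) (*-congˡ {ι e} (reflexive (P.cong (powerSum d) index)))))
    by-divisibility (no _) = sym (trans (*-congʳ {X} (trans (ι-cong (⊗-zeroʳ c)) ι-0)) (zeroˡ X))

  RHSᴷ≈antidiag : ∀ d r s ε₁ ε₂ → RHSᴷ d (suc r) (suc s) ε₁ ε₂ ≈ antidiag (r +ℕ s) (λ a b → ι (powF (ε₁ ⊗ ε₂) d) * defectTerm d r s a b)
  RHSᴷ≈antidiag d r s ε₁ ε₂ = begin
    RHSᴷ d (suc r) (suc s) ε₁ ε₂ ≈⟨ sum-filter (λ j → card ∸ 1 ∣? j) (D.range1 𝔽 (suc r +ℕ suc s ∸ 1)) _ ⟩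
    sumL (D.range1 𝔽 (r +ℕ suc s)) h ≈⟨ reflexive (P.cong (λ n → sumL (D.range1 𝔽 n) h) (ℕP.+-suc r s)) ⟩
    sumL (D.range1 𝔽 (suc (r +ℕ s))) h ≈⟨ sum-range1 (r +ℕ s) h ⟩
    antidiag (r +ℕ s) (λ a b → h (suc a)) ≈⟨ antidiag-cong (r +ℕ s) (admissibleTerm≈ d r s ε₁ ε₂) ⟩
    antidiag (r +ℕ s) (λ a b → ι (powF (ε₁ ⊗ ε₂) d) * defectTerm d r s a b) ∎
    where
    h : ℕ → K
    h = admissibleTerm d (suc r) (suc s) ε₁ ε₂


open import Defs using (LHS; RHS; _≈k_)
open import Data.Nat using (ℕ; _≤_; z≤n; s≤s; suc; _+_)
open import Relation.Binary.PropositionalEquality using (_≢_; subst₂)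
open import Algebra.Bundles using (CommutativeRing)

lemma2p3 : (𝔽 : FiniteField) (s₁ s₂ : ℕ) → 1 ≤ s₁ → 1 ≤ s₂ →
    (ε₁ ε₂ : FiniteField.Carrier 𝔽) →
    ε₁ ≢ FiniteField.𝟘 𝔽 → ε₂ ≢ FiniteField.𝟘 𝔽 →
    (d : ℕ) →
    _≈k_ 𝔽 (LHS 𝔽 d s₁ s₂ ε₁ ε₂) (RHS 𝔽 d s₁ s₂ ε₁ ε₂)
lemma2p3 𝔽 (suc r) (suc s) (s≤s z≤n) (s≤s z≤n) ε₁ ε₂ _ _ d =
  subst₂ (_≈k_ 𝔽) (frac-LHSᴷ d (suc r) (suc s) ε₁ ε₂) (frac-RHSᴷ d (suc r) (suc s) ε₁ ε₂) (≃⇒≈k identity)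
  where
  open PowerSumIdentity 𝔽
  open FieldProperties 𝔽 using (powF; _⊗_)
  open Fraction 𝔽 using (K; _≃_; ≃⇒≈k; fracRing)
  open Reciprocals 𝔽 using (ι)
  open PartialFractionExpansion 𝔽 fracRing using (antidiag; antidiag-*ˡ)
  open CommutativeRing fracRing using (_*_; _-_; *-congˡ)
  open import Relation.Binary.Reasoning.Setoid (CommutativeRing.setoid fracRing)
  e : K
  e = ι (powF (ε₁ ⊗ ε₂) d)
  identity : LHSᴷ d (suc r) (suc s) ε₁ ε₂ ≃ RHSᴷ d (suc r) (suc s) ε₁ ε₂
  identity = begin
    LHSᴷ d (suc r) (suc s) ε₁ ε₂ ≈⟨ LHSᴷ≈ι*defect d r s ε₁ ε₂ ⟩
    e * (powerSum d (suc r) * powerSum d (suc s) - powerSum d (suc r + suc s)) ≈⟨ *-congˡ {e} (powerSum-defect d r s) ⟩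
    e * antidiag (r + s) (defectTerm d r s) ≈⟨ antidiag-*ˡ (r + s) e (defectTerm d r s) ⟩
    antidiag (r + s) (λ a b → e * defectTerm d r s a b) ≈⟨ RHSᴷ≈antidiag d r s ε₁ ε₂ ⟨
    RHSᴷ d (suc r) (suc s) ε₁ ε₂ ∎
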